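{- For every nonempty connected graph $\Gamma$, \[\sum_{I\vdash\Gamma}(-1)^{|I|-1}|I|!\prod_{G\in I}\mathrm{HP}(\Gamma|_G)=(-1)^{|V_\Gamma|-1}\mathrm{HP}(\overline{\Gamma}),\] and, if $\Gamma$ moreover has at least one edge, \[\sum_{I\vdash\Gamma}(-1)^{|I|-1}(|I|-1)!\prod_{G\in I}\mathrm{HP}(\Gamma|_G)=\mathrm{HC}(\Gamma)+(-1)^{|V_\Gamma|-1}\mathrm{HC}(\overline{\Gamma}).\]
   Context: Graphs are finite, simple, undirected. $I\vdash\Gamma$ means $I$ is a partition of $V_\Gamma$ into blocks $G$ each inducing a connected subgraph $\Gamma|_G$; $|I|$ is the number of blocks. $\overline{\Gamma}$ is the complement graph (same vertices, complementary edges). $\mathrm{HP}(\Gamma)$ is the number of directed Hamiltonian paths of $\Gamma$, i.e. orderings $(v_1,\dots,v_n)$ of $V_\Gamma$ with $v_i$ adjacent to $v_{i+1}$ for all $i$ (so a one-vertex graph has $\mathrm{HP}=1$). $\mathrm{HC}(\Gamma)$ is the number of directed Hamiltonian cycles: for $|V_\Gamma|\ge3$, cyclic orderings $[v_1,\dots,v_n]$ (sequences up to rotation, not reflection) with consecutive vertices and $v_n,v_1$ adjacent; for a graph on two vertices, $\mathrm{HC}=1$ if they are adjacent and $0$ otherwise. -}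

module Defs where

open import Data.Nat using (ℕ; zero; suc)
open import Data.Nat using (_!)
open import Data.Bool using (Bool; true; false; _∧_; _∨_; not; if_then_else_)
open import Data.Fin using (Fin; zero; suc)
open import Data.Fin.Properties using (_≟_)
open import Data.List using (List; []; _∷_; [_]; map; concatMap; length; filterᵇ; allFin; foldr)
open import Data.Bool.ListAction using (all; any)
open import Data.Nat.ListAction using (product)
open import Data.Integer using (ℤ; +_; -_; _*_; _+_)
open import Relation.Nullary.Decidable using (⌊_⌋)
open import Relation.Binary.PropositionalEquality using (_≡_)
open import Data.Product using (∃₂)

record Graph (n : ℕ) : Set where
  field
    adj    : Fin n → Fin n → Bool
    adj-sym    : ∀ u v → adj u v ≡ adj v u
    adj-irrefl : ∀ u → adj u u ≡ false
open Graph public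

complement : ∀ {n} → Graph n → Graph n
complement {n} Γ = record { adj = cadj ; adj-sym = csym ; adj-irrefl = cirr }
  where
  open import Relation.Binary.PropositionalEquality using (refl; cong₂)
  open import Relation.Nullary using (yes; no)
  open import Relation.Binary.PropositionalEquality using (sym)
  cadj : Fin n → Fin n → Bool
  cadj u v = not (adj Γ u v) ∧ not ⌊ u ≟ v ⌋
  eqsym : ∀ u v → ⌊ u ≟ v ⌋ ≡ ⌊ v ≟ u ⌋
  eqsym u v with u ≟ v | v ≟ u
  ... | yes _ | yes _ = refl
  ... | no _ | no _ = refl
  ... | yes p | no q = Data.Empty.⊥-elim (q (sym p)) where import Data.Empty
  ... | no p | yes q = Data.Empty.⊥-elim (p (sym q)) where import Data.Empty
  csym : ∀ u v → cadj u v ≡ cadj v u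
  csym u v = cong₂ (λ a b → not a ∧ not b) (adj-sym Γ u v) (eqsym u v)
  cirr : ∀ u → cadj u u ≡ false
  cirr u with u ≟ u
  ... | yes _ = Data.Bool.Properties.∧-zeroʳ _ where import Data.Bool.Properties
  ... | no ¬p = Data.Empty.⊥-elim (¬p refl) where import Data.Empty

HasEdge : ∀ {n} → Graph n → Set
HasEdge Γ = ∃₂ λ u v → adj Γ u v ≡ true

-- Vertex subsets are represented as duplicate-free lists of vertices.

_∈ᵇ_ : ∀ {n} → Fin n → List (Fin n) → Bool
v ∈ᵇ B = any (λ u → ⌊ u ≟ v ⌋) B

-- reach Γ B u k v : v is reachable from u by a walk of length ≤ k
-- inside the induced subgraph Γ|_B
reach : ∀ {n} → Graph n → List (Fin n) → Fin n → ℕ → Fin n → Bool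
reach Γ B u zero    v = ⌊ u ≟ v ⌋
reach Γ B u (suc k) v =
  reach Γ B u k v ∨
  (v ∈ᵇ B ∧ any (λ w → reach Γ B u k w ∧ adj Γ w v) B)

-- Γ|_B is connected: any two vertices of B are joined by a walk in Γ|_B
-- (walks of length ≤ |B| suffice, since a shortest path has length < |B|)
connectedᵇ : ∀ {n} → Graph n → List (Fin n) → Bool
connectedᵇ Γ B = all (λ u → all (λ v → reach Γ B u (length B) v) B) B

Connected : ∀ {n} → Graph n → Set
Connected {n} Γ = connectedᵇ Γ (allFin n) ≡ true

insertEach : {A : Set} → A → List (List A) → List (List (List A))
insertEach x []       = []
insertEach x (b ∷ bs) = ((x ∷ b) ∷ bs) ∷ map (b ∷_) (insertEach x bs)

partitions : {A : Set} → List A → List (List (List A))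
partitions []       = [ [] ]
partitions (x ∷ xs) = concatMap (λ p → ([ x ] ∷ p) ∷ insertEach x p) (partitions xs)

connPartitions : ∀ {n} → Graph n → List (List (List (Fin n)))
connPartitions {n} Γ = filterᵇ (all (connectedᵇ Γ)) (partitions (allFin n))

insertAll : {A : Set} → A → List A → List (List A)
insertAll x []       = [ [ x ] ]
insertAll x (y ∷ ys) = (x ∷ y ∷ ys) ∷ map (y ∷_) (insertAll x ys)

perms : {A : Set} → List A → List (List A)
perms []       = [ [] ]
perms (x ∷ xs) = concatMap (insertAll x) (perms xs)

isPath : ∀ {n} → Graph n → List (Fin n) → Bool
isPath Γ []           = true
isPath Γ (x ∷ [])     = true
isPath Γ (x ∷ y ∷ zs) = adj Γ x y ∧ isPath Γ (y ∷ zs)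

countᵇ : {A : Set} → (A → Bool) → List A → ℕ
countᵇ p xs = length (filterᵇ p xs)

HPon : ∀ {n} → Graph n → List (Fin n) → ℕ
HPon Γ B = countᵇ (isPath Γ) (perms B)

HP : ∀ {n} → Graph n → ℕ
HP {n} Γ = HPon Γ (allFin n)

lastAdjFirst : ∀ {n} → Graph n → Fin n → List (Fin n) → Bool
lastAdjFirst Γ x []       = adj Γ x x
lastAdjFirst Γ x (y ∷ []) = adj Γ y x
lastAdjFirst Γ x (y ∷ z ∷ zs) = lastAdjFirst Γ x (z ∷ zs)

-- HC(Γ): directed Hamiltonian cycles [v_1,...,v_n] up to rotation.
-- Each rotation class has a unique representative starting with vertex 0,
-- so we count orderings (0, v_2, ..., v_n) with consecutive vertices and
-- v_n, 0 adjacent.  For n = 2 this gives 1 iff the two vertices are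
-- adjacent, matching the paper's convention.
HC : ∀ {n} → Graph n → ℕ
HC {zero}  Γ = 0
HC {suc n} Γ =
  countᵇ (λ p → isPath Γ (zero ∷ p) ∧ lastAdjFirst Γ zero p)
         (perms (map suc (allFin n)))

neg1^ : ℕ → ℤ
neg1^ zero    = + 1
neg1^ (suc k) = - neg1^ k

sumℤ : List ℤ → ℤ
sumℤ = foldr _+_ (+ 0)

LHS₁ : ∀ {n} → Graph n → ℤ
LHS₁ Γ = sumℤ (map (λ I → neg1^ (length I Data.Nat.∸ 1) * + ((length I) !)
                              * + product (map (HPon Γ) I))
                   (connPartitions Γ))
  where import Data.Nat

LHS₂ : ∀ {n} → Graph n → ℤ
LHS₂ Γ = sumℤ (map (λ I → neg1^ (length I Data.Nat.∸ 1) * + ((length I Data.Nat.∸ 1) !)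
                              * + product (map (HPon Γ) I))
                   (connPartitions Γ))
  where import Data.Nat

-- Call a word σ of vertices an anti-path if no two consecutive entries are adjacent in Γ, and let
-- h(σ) = (-1)^|σ| [σ is an anti-path]. Then h(σ) = [σ = ε] - Σ_{σ = s t, s ≠ ε} [s is a Γ-path] h(t),
-- i.e. h inverts the Γ-path indicator under concatenation of words. Summed over the orderings of a vertex
-- set B this becomes a recurrence over the splittings B = G ⊔ H with G ≠ ∅ and weight HP(Γ|_G), and the
-- partition sum Σ_I (-1)^|I| |I|! ∏ HP(Γ|_G) obeys the same recurrence (mark one of the |I| blocks).
-- Hence the two agree, and for B = V_Γ the anti-path sum is (-1)^|V| HP(Γ̄), since anti-paths with
-- distinct entries are the paths of Γ̄. Partitions with a disconnected block contribute nothing, since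
-- that block has no Hamiltonian path.
--
-- For the second identity fix a vertex x and split off its block x ∷ G: a Hamiltonian path of the block
-- cuts at x into a path ending at x and one starting at x, and the remaining blocks give the partition
-- sum, hence the anti-path sum, of the rest H. The three pieces (path into x, path out of x, anti-path)
-- can be rotated, which turns the total into a sum over the orderings π of V ∖ x of an alternating sum
-- over the cuts π = β τ α; that sum telescopes to [x π x is a cycle of Γ] + (-1)^|π| [x π x is a cycle
-- of Γ̄].

module Submission where

open import Defs

open import Data.Bool using (Bool; true; false; _∧_; _∨_; not)
open import Data.Bool.Properties using (∧-identityʳ; ∧-assoc; ∨-zeroʳ)
open import Data.Bool.ListAction using (all; any)
open import Data.Empty using (⊥-elim)
open import Data.Fin using (Fin; zero; suc)
open import Data.Fin.Properties using (_≟_)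
open import Data.Integer using (ℤ; +_; -_; _*_; _+_; _-_)
import Data.Integer.Properties as ℤP
open import Data.Integer.Tactic.RingSolver using (solve-∀)
open import Data.List using (List; []; _∷_; [_]; map; concatMap; _++_; length; filterᵇ; allFin)
import Data.List.Properties as ListP
open import Data.List.Membership.Propositional using (_∈_)
open import Data.List.Relation.Binary.Permutation.Propositional as ↭ using (_↭_; prep; swap; ↭-sym)
import Data.List.Relation.Binary.Permutation.Propositional.Properties as ↭P
import Data.List.Relation.Binary.Permutation.Setoid.Properties as ↭ₛP
open import Data.List.Relation.Unary.All as All using (All; []; _∷_)
import Data.List.Relation.Unary.All.Properties as AllP
open import Data.List.Relation.Unary.AllPairs using (_∷_)
open import Data.List.Relation.Unary.Any using (here; there)
open import Data.List.Relation.Unary.Linked using (Linked; []; [-]; _∷_)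
open import Data.List.Relation.Unary.Linked.Properties using (AllPairs⇒Linked)
open import Data.List.Relation.Unary.Unique.Propositional using (Unique)
import Data.List.Relation.Unary.Unique.Propositional.Properties as UniqueP
open import Data.Nat as ℕ using (ℕ; zero; suc; _!; _≤_; s≤s; z≤n)
import Data.Nat.Properties as ℕP
open import Data.Nat.ListAction using (product)
open import Data.Product using (_×_; _,_; proj₁; proj₂)
open import Relation.Binary.PropositionalEquality
  using (_≡_; _≢_; refl; sym; trans; cong; cong₂; subst; setoid; module ≡-Reasoning)
open import Relation.Nullary.Decidable using (⌊_⌋; yes; no)

private
  variable
    A B : Set

Σ : List A → (A → ℤ) → ℤ
Σ xs f = sumℤ (map f xs)

Σ₂ : List (A × B) → (A → B → ℤ) → ℤ
Σ₂ xs f = Σ xs (λ p → f (proj₁ p) (proj₂ p))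

Σ-++ : (xs ys : List A) (f : A → ℤ) → Σ (xs ++ ys) f ≡ Σ xs f + Σ ys f
Σ-++ []       ys f = sym (ℤP.+-identityˡ _)
Σ-++ (x ∷ xs) ys f = trans (cong (_+_ (f x)) (Σ-++ xs ys f)) (sym (ℤP.+-assoc (f x) _ _))

Σ-map : (g : A → B) (xs : List A) (f : B → ℤ) → Σ (map g xs) f ≡ Σ xs (λ x → f (g x))
Σ-map g []       f = refl
Σ-map g (x ∷ xs) f = cong (_+_ (f (g x))) (Σ-map g xs f)

Σ-concatMap : (g : A → List B) (xs : List A) (f : B → ℤ) →
  Σ (concatMap g xs) f ≡ Σ xs (λ x → Σ (g x) f)
Σ-concatMap g []       f = refl
Σ-concatMap g (x ∷ xs) f =
  trans (Σ-++ (g x) (concatMap g xs) f) (cong (_+_ (Σ (g x) f)) (Σ-concatMap g xs f))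

Σ-cong : (xs : List A) {f g : A → ℤ} → (∀ x → f x ≡ g x) → Σ xs f ≡ Σ xs g
Σ-cong []       e = refl
Σ-cong (x ∷ xs) e = cong₂ _+_ (e x) (Σ-cong xs e)

Σ-cong-All : {xs : List A} {f g : A → ℤ} → All (λ x → f x ≡ g x) xs → Σ xs f ≡ Σ xs g
Σ-cong-All []       = refl
Σ-cong-All (e ∷ es) = cong₂ _+_ e (Σ-cong-All es)

Σ-zero : (xs : List A) → Σ xs (λ _ → + 0) ≡ + 0
Σ-zero []       = refl
Σ-zero (x ∷ xs) = trans (ℤP.+-identityˡ _) (Σ-zero xs)

Σ-+ : (xs : List A) (f g : A → ℤ) → Σ xs (λ x → f x + g x) ≡ Σ xs f + Σ xs g
Σ-+ []       f g = refl
Σ-+ (x ∷ xs) f g = trans (cong (_+_ (f x + g x)) (Σ-+ xs f g)) (interchange (f x) (g x) _ _)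
  where
  interchange : ∀ a b c d → a + b + (c + d) ≡ a + c + (b + d)
  interchange = solve-∀

Σ-neg : (xs : List A) (f : A → ℤ) → Σ xs (λ x → - f x) ≡ - Σ xs f
Σ-neg []       f = refl
Σ-neg (x ∷ xs) f = trans (cong (_+_ (- f x)) (Σ-neg xs f)) (sym (ℤP.neg-distrib-+ (f x) _))

Σ-minus : (xs : List A) (f g : A → ℤ) → Σ xs (λ x → f x - g x) ≡ Σ xs f - Σ xs g
Σ-minus xs f g = trans (Σ-+ xs f (λ x → - g x)) (cong (_+_ (Σ xs f)) (Σ-neg xs g))

Σ-*ˡ : (c : ℤ) (xs : List A) (f : A → ℤ) → Σ xs (λ x → c * f x) ≡ c * Σ xs f
Σ-*ˡ c []       f = sym (ℤP.*-zeroʳ c)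
Σ-*ˡ c (x ∷ xs) f = trans (cong (_+_ (c * f x)) (Σ-*ˡ c xs f)) (sym (ℤP.*-distribˡ-+ c (f x) _))

Σ-*ʳ : (c : ℤ) (xs : List A) (f : A → ℤ) → Σ xs (λ x → f x * c) ≡ Σ xs f * c
Σ-*ʳ c xs f = trans (Σ-cong xs (λ x → ℤP.*-comm (f x) c)) (trans (Σ-*ˡ c xs f) (ℤP.*-comm c _))

Σ-swap : (xs : List A) (ys : List B) (f : A → B → ℤ) →
  Σ xs (λ x → Σ ys (f x)) ≡ Σ ys (λ y → Σ xs (λ x → f x y))
Σ-swap []       ys f = sym (Σ-zero ys)
Σ-swap (x ∷ xs) ys f =
  trans (cong (_+_ (Σ ys (f x))) (Σ-swap xs ys f)) (sym (Σ-+ ys (f x) (λ y → Σ xs (λ x′ → f x′ y))))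

Σ-filterᵇ : (p : A → Bool) (xs : List A) (f : A → ℤ) → (∀ x → p x ≡ false → f x ≡ + 0) →
  Σ (filterᵇ p xs) f ≡ Σ xs f
Σ-filterᵇ p []       f f≡0 = refl
Σ-filterᵇ p (x ∷ xs) f f≡0 with p x in px
... | true  = cong (_+_ (f x)) (Σ-filterᵇ p xs f f≡0)
... | false = trans (Σ-filterᵇ p xs f f≡0)
  (trans (sym (ℤP.+-identityˡ _)) (cong (λ z → z + Σ xs f) (sym (f≡0 x px))))

𝟙 : Bool → ℤ
𝟙 true  = + 1
𝟙 false = + 0

𝟙-∧ : ∀ a b → 𝟙 (a ∧ b) ≡ 𝟙 a * 𝟙 b
𝟙-∧ true  b = sym (ℤP.*-identityˡ (𝟙 b))
𝟙-∧ false b = refl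

countᵇ≡Σ : (p : A → Bool) (xs : List A) → + countᵇ p xs ≡ Σ xs (λ x → 𝟙 (p x))
countᵇ≡Σ p []       = refl
countᵇ≡Σ p (x ∷ xs) with p x
... | true  = trans (ℤP.pos-+ 1 (countᵇ p xs)) (cong (_+_ (+ 1)) (countᵇ≡Σ p xs))
... | false = trans (countᵇ≡Σ p xs) (sym (ℤP.+-identityˡ _))

countᵇ-none : (p : A → Bool) {xs : List A} → All (λ x → p x ≡ false) xs → countᵇ p xs ≡ 0
countᵇ-none p []               = refl
countᵇ-none p (px≡false ∷ pxs) rewrite px≡false = countᵇ-none p pxs

isNil isCons : List A → ℤ
isNil []      = + 1
isNil (_ ∷ _) = + 0
isCons []      = + 0
isCons (_ ∷ _) = + 1

consRest : B → B × List B → B × List B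
consRest b (c , r) = (c , b ∷ r)

selections : List B → List (B × List B)
selections []       = []
selections (b ∷ bs) = (b , bs) ∷ map (consRest b) (selections bs)

module _ {A : Set} where

  cons₁ cons₂ : A → List A × List A → List A × List A
  cons₁ x (a , b) = (x ∷ a , b)
  cons₂ x (a , b) = (a , x ∷ b)

  splits : List A → List (List A × List A)
  splits []       = ([] , []) ∷ []
  splits (x ∷ xs) = ([] , x ∷ xs) ∷ map (cons₁ x) (splits xs)

  bipartitions : List A → List (List A × List A)
  bipartitions []       = ([] , []) ∷ []
  bipartitions (x ∷ xs) = map (cons₁ x) (bipartitions xs) ++ map (cons₂ x) (bipartitions xs)

  Σ₂-map-cons₁ : (x : A) (ps : List (List A × List A)) (f : List A → List A → ℤ) →
    Σ₂ (map (cons₁ x) ps) f ≡ Σ₂ ps (λ a b → f (x ∷ a) b)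
  Σ₂-map-cons₁ x ps f = Σ-map (cons₁ x) ps _

  Σ₂-map-cons₂ : (x : A) (ps : List (List A × List A)) (f : List A → List A → ℤ) →
    Σ₂ (map (cons₂ x) ps) f ≡ Σ₂ ps (λ a b → f a (x ∷ b))
  Σ₂-map-cons₂ x ps f = Σ-map (cons₂ x) ps _

  Σ₂-bipartitions-∷ : (x : A) (xs : List A) (f : List A → List A → ℤ) →
    Σ₂ (bipartitions (x ∷ xs)) f
      ≡ Σ₂ (bipartitions xs) (λ a b → f (x ∷ a) b) + Σ₂ (bipartitions xs) (λ a b → f a (x ∷ b))
  Σ₂-bipartitions-∷ x xs f = trans (Σ-++ (map (cons₁ x) (bipartitions xs)) _ _)
    (cong₂ _+_ (Σ₂-map-cons₁ x (bipartitions xs) f) (Σ₂-map-cons₂ x (bipartitions xs) f))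

  Σ-insertAll : (x : A) (l : List A) (f : List A → ℤ) →
    Σ (insertAll x l) f ≡ Σ₂ (splits l) (λ a b → f (a ++ x ∷ b))
  Σ-insertAll x []       f = refl
  Σ-insertAll x (y ∷ ys) f = cong (_+_ (f (x ∷ y ∷ ys)))
    (trans (Σ-map (y ∷_) (insertAll x ys) f)
    (trans (Σ-insertAll x ys (λ σ → f (y ∷ σ))) (sym (Σ-map (cons₁ y) (splits ys) _))))

  -- x lands either in the left or in the right part.
  Σ-insertAll-splits : (x : A) (l : List A) (g : List A → List A → ℤ) →
    Σ (insertAll x l) (λ σ → Σ₂ (splits σ) g)
      ≡ Σ₂ (splits l) (λ s t → Σ (insertAll x s) (λ s′ → g s′ t) + Σ (insertAll x t) (g s))
  Σ-insertAll-splits x [] g = rearrange (g [] (x ∷ [])) (g (x ∷ []) [])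
    where
    rearrange : ∀ a b → a + (b + + 0) + + 0 ≡ (b + + 0) + (a + + 0) + + 0
    rearrange = solve-∀
  Σ-insertAll-splits x (y ∷ ys) g = begin
      Σ₂ (splits (x ∷ y ∷ ys)) g + Σ (map (y ∷_) (insertAll x ys)) (λ σ → Σ₂ (splits σ) g)
    ≡⟨ cong₂ _+_
         (cong (_+_ a) (trans (Σ₂-map-cons₁ x (splits (y ∷ ys)) g) (cong (_+_ b) (Σ₂-map-cons₁ y (splits ys) _))))
         (Σ-map (y ∷_) (insertAll x ys) _) ⟩
      (a + (b + c)) + Σ (insertAll x ys) (λ σ → g [] (y ∷ σ) + Σ₂ (map (cons₁ y) (splits σ)) g)
    ≡⟨ cong (_+_ (a + (b + c))) (trans (Σ-+ (insertAll x ys) _ _)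
         (cong (_+_ d) (trans (Σ-cong (insertAll x ys) (λ σ → Σ₂-map-cons₁ y (splits σ) g))
                              (Σ-insertAll-splits x ys (λ s t → g (y ∷ s) t))))) ⟩
      (a + (b + c)) + (d + e)
    ≡⟨ rearrange a b c d e ⟩
      ((b + + 0) + (a + d)) + (c + e)
    ≡⟨ cong (λ z → ((b + + 0) + (a + z)) + (c + e)) (sym (Σ-map (y ∷_) (insertAll x ys) (g []))) ⟩
      ((b + + 0) + (a + Σ (map (y ∷_) (insertAll x ys)) (g []))) + (c + e)
    ≡⟨ cong (_+_ ((b + + 0) + (a + Σ (map (y ∷_) (insertAll x ys)) (g []))))
         (sym (trans (Σ₂-map-cons₁ y (splits ys) K) (trans (Σ-cong (splits ys) K-cons) (Σ-+ (splits ys) _ _)))) ⟩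
      K [] (y ∷ ys) + Σ₂ (map (cons₁ y) (splits ys)) K
    ∎
    where
    open ≡-Reasoning
    K : List A → List A → ℤ
    K s t = Σ (insertAll x s) (λ s′ → g s′ t) + Σ (insertAll x t) (g s)
    a = g [] (x ∷ y ∷ ys)
    b = g (x ∷ []) (y ∷ ys)
    c = Σ₂ (splits ys) (λ s t → g (x ∷ y ∷ s) t)
    d = Σ (insertAll x ys) (λ σ → g [] (y ∷ σ))
    e = Σ₂ (splits ys) (λ s t → Σ (insertAll x s) (λ s′ → g (y ∷ s′) t) + Σ (insertAll x t) (g (y ∷ s)))
    K-cons : (p : List A × List A) →
      K (y ∷ proj₁ p) (proj₂ p)
        ≡ g (x ∷ y ∷ proj₁ p) (proj₂ p)
          + (Σ (insertAll x (proj₁ p)) (λ s′ → g (y ∷ s′) (proj₂ p)) + Σ (insertAll x (proj₂ p)) (g (y ∷ proj₁ p)))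
    K-cons (s , t) = trans (ℤP.+-assoc (g (x ∷ y ∷ s) t) _ _)
      (cong (λ z → g (x ∷ y ∷ s) t + (z + Σ (insertAll x t) (g (y ∷ s))))
            (Σ-map (y ∷_) (insertAll x s) (λ s′ → g s′ t)))
    rearrange : ∀ a b c d e → (a + (b + c)) + (d + e) ≡ ((b + + 0) + (a + d)) + (c + e)
    rearrange = solve-∀

  -- A permutation of B cut into two pieces is the same as a bipartition of B with a permutation of each part.
  Σ-perms-splits : (B : List A) (g : List A → List A → ℤ) →
    Σ (perms B) (λ σ → Σ₂ (splits σ) g)
      ≡ Σ₂ (bipartitions B) (λ G H → Σ (perms G) (λ s → Σ (perms H) (g s)))
  Σ-perms-splits [] g = cong (λ z → z + + 0) (sym (ℤP.+-identityʳ (g [] [] + + 0)))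
  Σ-perms-splits (x ∷ xs) g = begin
      Σ (concatMap (insertAll x) (perms xs)) (λ σ → Σ₂ (splits σ) g)
    ≡⟨ Σ-concatMap (insertAll x) (perms xs) _ ⟩
      Σ (perms xs) (λ σ → Σ (insertAll x σ) (λ σ′ → Σ₂ (splits σ′) g))
    ≡⟨ Σ-cong (perms xs) (λ σ → Σ-insertAll-splits x σ g) ⟩
      Σ (perms xs) (λ σ → Σ₂ (splits σ) (λ s t → g₁ s t + g₂ s t))
    ≡⟨ Σ-perms-splits xs (λ s t → g₁ s t + g₂ s t) ⟩
      Σ₂ (bipartitions xs) (λ G H → Σ (perms G) (λ s → Σ (perms H) (λ t → g₁ s t + g₂ s t)))
    ≡⟨ trans (Σ-cong (bipartitions xs) (λ p → ΣΣ-+ (perms (proj₁ p)) (perms (proj₂ p)))) (Σ-+ (bipartitions xs) _ _) ⟩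
      Σ₂ (bipartitions xs) (λ G H → Σ (perms G) (λ s → Σ (perms H) (g₁ s)))
        + Σ₂ (bipartitions xs) (λ G H → Σ (perms G) (λ s → Σ (perms H) (g₂ s)))
    ≡⟨ sym (cong₂ _+_ (Σ-cong (bipartitions xs) (λ p → insert-left (proj₁ p) (proj₂ p)))
                      (Σ-cong (bipartitions xs) (λ p → insert-right (proj₁ p) (proj₂ p)))) ⟩
      Σ₂ (bipartitions xs) (λ G H → Φ (x ∷ G) H) + Σ₂ (bipartitions xs) (λ G H → Φ G (x ∷ H))
    ≡⟨ sym (Σ₂-bipartitions-∷ x xs Φ) ⟩
      Σ₂ (bipartitions (x ∷ xs)) Φ
    ∎
    where
    open ≡-Reasoning
    g₁ g₂ : List A → List A → ℤ
    g₁ s t = Σ (insertAll x s) (λ s′ → g s′ t)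
    g₂ s t = Σ (insertAll x t) (g s)
    Φ : List A → List A → ℤ
    Φ G H = Σ (perms G) (λ s → Σ (perms H) (g s))
    ΣΣ-+ : (U V : List (List A)) →
      Σ U (λ s → Σ V (λ t → g₁ s t + g₂ s t)) ≡ Σ U (λ s → Σ V (g₁ s)) + Σ U (λ s → Σ V (g₂ s))
    ΣΣ-+ U V = trans (Σ-cong U (λ s → Σ-+ V (g₁ s) (g₂ s))) (Σ-+ U _ _)
    insert-left : ∀ G H → Φ (x ∷ G) H ≡ Σ (perms G) (λ s → Σ (perms H) (g₁ s))
    insert-left G H = trans (Σ-concatMap (insertAll x) (perms G) _)
      (Σ-cong (perms G) (λ s → Σ-swap (insertAll x s) (perms H) g))
    insert-right : ∀ G H → Φ G (x ∷ H) ≡ Σ (perms G) (λ s → Σ (perms H) (g₂ s))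
    insert-right G H = Σ-cong (perms G) (λ s → Σ-concatMap (insertAll x) (perms H) (g s))

  Σ-bipartitions-emptyˡ : (xs : List A) (f : List A → List A → ℤ) →
    Σ₂ (bipartitions xs) f ≡ f [] xs + Σ₂ (bipartitions xs) (λ G H → isCons G * f G H)
  Σ-bipartitions-emptyˡ [] f = refl
  Σ-bipartitions-emptyˡ (y ∷ ys) f = begin
      Σ₂ (bipartitions (y ∷ ys)) f
    ≡⟨ Σ₂-bipartitions-∷ y ys f ⟩
      l + Σ₂ (bipartitions ys) (λ a b → f a (y ∷ b))
    ≡⟨ cong (_+_ l) (Σ-bipartitions-emptyˡ ys (λ a b → f a (y ∷ b))) ⟩
      l + (f [] (y ∷ ys) + r)
    ≡⟨ rearrange l (f [] (y ∷ ys)) r ⟩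
      f [] (y ∷ ys) + (l + r)
    ≡⟨ cong (λ z → f [] (y ∷ ys) + (z + r))
         (Σ-cong (bipartitions ys) (λ p → sym (ℤP.*-identityˡ (f (y ∷ proj₁ p) (proj₂ p))))) ⟩
      f [] (y ∷ ys) + (Σ₂ (bipartitions ys) (λ G H → isCons (y ∷ G) * f (y ∷ G) H) + r)
    ≡⟨ cong (_+_ (f [] (y ∷ ys))) (sym (Σ₂-bipartitions-∷ y ys (λ G H → isCons G * f G H))) ⟩
      f [] (y ∷ ys) + Σ₂ (bipartitions (y ∷ ys)) (λ G H → isCons G * f G H)
    ∎
    where
    open ≡-Reasoning
    l = Σ₂ (bipartitions ys) (λ a b → f (y ∷ a) b)
    r = Σ₂ (bipartitions ys) (λ G H → isCons G * f G (y ∷ H))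
    rearrange : ∀ a b c → a + (b + c) ≡ b + (a + c)
    rearrange = solve-∀

  Σ₂-map-consRest : (b : List A) (ps : List (List A × List (List A))) (f : List A → List (List A) → ℤ) →
    Σ₂ (map (consRest b) ps) f ≡ Σ₂ ps (λ c r → f c (b ∷ r))
  Σ₂-map-consRest b ps f = Σ-map (consRest b) ps _

  Σ-insertEach-selections : (x : A) (p : List (List A)) (F : List A → List (List A) → ℤ) →
    Σ (insertEach x p) (λ q → Σ₂ (selections q) F)
      ≡ Σ₂ (selections p) (λ b r → F (x ∷ b) r + Σ (insertEach x r) (F b))
  Σ-insertEach-selections x []       F = refl
  Σ-insertEach-selections x (b ∷ bs) F = begin
      (F (x ∷ b) bs + Σ₂ (map (consRest (x ∷ b)) (selections bs)) F)
        + Σ (map (b ∷_) (insertEach x bs)) (λ q → Σ₂ (selections q) F)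
    ≡⟨ cong₂ _+_ (cong (_+_ (F (x ∷ b) bs)) (Σ₂-map-consRest (x ∷ b) (selections bs) F))
         (trans (Σ-map (b ∷_) (insertEach x bs) _)
         (trans (Σ-+ (insertEach x bs) _ _)
           (cong (_+_ γ) (trans (Σ-cong (insertEach x bs) (λ q → Σ₂-map-consRest b (selections q) F))
                                (Σ-insertEach-selections x bs (λ c r → F c (b ∷ r))))))) ⟩
      (α + β) + (γ + δ)
    ≡⟨ interchange α β γ δ ⟩
      (α + γ) + (β + δ)
    ≡⟨ cong (_+_ (α + γ)) (sym (trans (Σ₂-map-consRest b (selections bs) G)
         (trans (Σ-cong (selections bs) G-cons) (Σ-+ (selections bs) _ _)))) ⟩
      G b bs + Σ₂ (map (consRest b) (selections bs)) G
    ∎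
    where
    open ≡-Reasoning
    G : List A → List (List A) → ℤ
    G c r = F (x ∷ c) r + Σ (insertEach x r) (F c)
    α = F (x ∷ b) bs
    β = Σ₂ (selections bs) (λ c r → F c ((x ∷ b) ∷ r))
    γ = Σ (insertEach x bs) (F b)
    δ = Σ₂ (selections bs) (λ c r → F (x ∷ c) (b ∷ r) + Σ (insertEach x r) (λ r′ → F c (b ∷ r′)))
    interchange : ∀ a b c d → (a + b) + (c + d) ≡ (a + c) + (b + d)
    interchange = solve-∀
    rearrange : ∀ a b c → a + (b + c) ≡ b + (a + c)
    rearrange = solve-∀
    G-cons : (p : List A × List (List A)) →
      G (proj₁ p) (b ∷ proj₂ p)
        ≡ F (proj₁ p) ((x ∷ b) ∷ proj₂ p)
          + (F (x ∷ proj₁ p) (b ∷ proj₂ p) + Σ (insertEach x (proj₂ p)) (λ r′ → F (proj₁ p) (b ∷ r′)))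
    G-cons (c , r) =
      trans (cong (λ z → F (x ∷ c) (b ∷ r) + (F c ((x ∷ b) ∷ r) + z)) (Σ-map (b ∷_) (insertEach x r) (F c)))
            (rearrange (F (x ∷ c) (b ∷ r)) (F c ((x ∷ b) ∷ r)) _)

  -- A partition of B with a distinguished block G is a bipartition (G , H) with G nonempty and a partition of H.
  Σ-partitions-selections : (B : List A) (F : List A → List (List A) → ℤ) →
    Σ (partitions B) (λ I → Σ₂ (selections I) F)
      ≡ Σ₂ (bipartitions B) (λ G H → isCons G * Σ (partitions H) (F G))
  Σ-partitions-selections []       F = refl
  Σ-partitions-selections (x ∷ xs) F = begin
      Σ (concatMap (λ p → ([ x ] ∷ p) ∷ insertEach x p) (partitions xs)) Ψ
    ≡⟨ Σ-concatMap _ (partitions xs) Ψ ⟩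
      Σ (partitions xs) (λ p → Ψ ([ x ] ∷ p) + Σ (insertEach x p) Ψ)
    ≡⟨ Σ-cong (partitions xs) Ψ-split ⟩
      Σ (partitions xs) (λ p → F [ x ] p + Σ₂ (selections p) F′)
    ≡⟨ Σ-+ (partitions xs) _ _ ⟩
      Σ (partitions xs) (F [ x ]) + Σ (partitions xs) (λ p → Σ₂ (selections p) F′)
    ≡⟨ cong (_+_ (Σ (partitions xs) (F [ x ])))
         (trans (Σ-partitions-selections xs F′) (trans (Σ-cong (bipartitions xs) F′-split) (Σ-+ (bipartitions xs) _ _))) ⟩
      Σ (partitions xs) (F [ x ]) + (Σ₂ (bipartitions xs) (λ G H → isCons G * Σ (partitions H) (F (x ∷ G)))
        + Σ₂ (bipartitions xs) (λ G H → R G (x ∷ H)))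
    ≡⟨ sym (ℤP.+-assoc (Σ (partitions xs) (F [ x ])) _ _) ⟩
      (Σ (partitions xs) (F [ x ]) + Σ₂ (bipartitions xs) (λ G H → isCons G * Σ (partitions H) (F (x ∷ G))))
        + Σ₂ (bipartitions xs) (λ G H → R G (x ∷ H))
    ≡⟨ cong (λ z → z + Σ₂ (bipartitions xs) (λ G H → R G (x ∷ H)))
         (sym (Σ-bipartitions-emptyˡ xs (λ G H → Σ (partitions H) (F (x ∷ G))))) ⟩
      Σ₂ (bipartitions xs) (λ G H → Σ (partitions H) (F (x ∷ G))) + Σ₂ (bipartitions xs) (λ G H → R G (x ∷ H))
    ≡⟨ cong (λ z → z + Σ₂ (bipartitions xs) (λ G H → R G (x ∷ H)))
         (Σ-cong (bipartitions xs) (λ p → sym (ℤP.*-identityˡ _))) ⟩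
      Σ₂ (bipartitions xs) (λ G H → R (x ∷ G) H) + Σ₂ (bipartitions xs) (λ G H → R G (x ∷ H))
    ≡⟨ sym (Σ₂-bipartitions-∷ x xs R) ⟩
      Σ₂ (bipartitions (x ∷ xs)) R
    ∎
    where
    open ≡-Reasoning
    Ψ : List (List A) → ℤ
    Ψ I = Σ₂ (selections I) F
    R : List A → List A → ℤ
    R G H = isCons G * Σ (partitions H) (F G)
    F′ : List A → List (List A) → ℤ
    F′ c r = F c ([ x ] ∷ r) + (F (x ∷ c) r + Σ (insertEach x r) (F c))
    Ψ-split : (p : List (List A)) → Ψ ([ x ] ∷ p) + Σ (insertEach x p) Ψ ≡ F [ x ] p + Σ₂ (selections p) F′
    Ψ-split p = begin
        (F [ x ] p + Σ₂ (map (consRest [ x ]) (selections p)) F) + Σ (insertEach x p) Ψ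
      ≡⟨ cong₂ (λ u v → (F [ x ] p + u) + v) (Σ₂-map-consRest [ x ] (selections p) F) (Σ-insertEach-selections x p F) ⟩
        (F [ x ] p + Σ₂ (selections p) (λ c r → F c ([ x ] ∷ r)))
          + Σ₂ (selections p) (λ b r → F (x ∷ b) r + Σ (insertEach x r) (F b))
      ≡⟨ trans (ℤP.+-assoc (F [ x ] p) _ _) (cong (_+_ (F [ x ] p)) (sym (Σ-+ (selections p) _ _))) ⟩
        F [ x ] p + Σ₂ (selections p) F′
      ∎
    distrib : ∀ n a b c → n * (a + (b + c)) ≡ n * b + n * (a + c)
    distrib = solve-∀
    F′-split : (q : List A × List A) →
      isCons (proj₁ q) * Σ (partitions (proj₂ q)) (F′ (proj₁ q))
        ≡ isCons (proj₁ q) * Σ (partitions (proj₂ q)) (F (x ∷ proj₁ q)) + R (proj₁ q) (x ∷ proj₂ q)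
    F′-split (G , H) = begin
        isCons G * Σ (partitions H) (F′ G)
      ≡⟨ cong (_*_ (isCons G)) (trans (Σ-+ (partitions H) _ _) (cong (_+_ a) (Σ-+ (partitions H) _ _))) ⟩
        isCons G * (a + (b + c))
      ≡⟨ distrib (isCons G) a b c ⟩
        isCons G * b + isCons G * (a + c)
      ≡⟨ cong (λ z → isCons G * b + isCons G * z)
           (sym (trans (Σ-concatMap _ (partitions H) (F G)) (Σ-+ (partitions H) _ _))) ⟩
        isCons G * b + R G (x ∷ H)
      ∎
      where
      a = Σ (partitions H) (λ J → F G ([ x ] ∷ J))
      b = Σ (partitions H) (F (x ∷ G))
      c = Σ (partitions H) (λ J → Σ (insertEach x J) (F G))

  Triple : Set
  Triple = List A × List A × List A

  Σ₃ : List Triple → (List A → List A → List A → ℤ) → ℤ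
  Σ₃ ts f = Σ ts (λ t → f (proj₁ t) (proj₁ (proj₂ t)) (proj₂ (proj₂ t)))

  into₁ into₂ into₃ : A → Triple → Triple
  into₁ x (a , b , c) = (x ∷ a , b , c)
  into₂ x (a , b , c) = (a , x ∷ b , c)
  into₃ x (a , b , c) = (a , b , x ∷ c)

  tripartitions : List A → List Triple
  tripartitions []       = ([] , [] , []) ∷ []
  tripartitions (x ∷ xs) =
    map (into₁ x) (tripartitions xs) ++ (map (into₂ x) (tripartitions xs) ++ map (into₃ x) (tripartitions xs))

  Σ₃-tripartitions-∷ : (x : A) (xs : List A) (F : List A → List A → List A → ℤ) →
    Σ₃ (tripartitions (x ∷ xs)) F
      ≡ Σ₃ (tripartitions xs) (λ a b c → F (x ∷ a) b c)
        + (Σ₃ (tripartitions xs) (λ a b c → F a (x ∷ b) c) + Σ₃ (tripartitions xs) (λ a b c → F a b (x ∷ c)))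
  Σ₃-tripartitions-∷ x xs F = trans (Σ-++ (map (into₁ x) (tripartitions xs)) _ _)
    (cong₂ _+_ (Σ-map (into₁ x) (tripartitions xs) _)
      (trans (Σ-++ (map (into₂ x) (tripartitions xs)) _ _)
        (cong₂ _+_ (Σ-map (into₂ x) (tripartitions xs) _) (Σ-map (into₃ x) (tripartitions xs) _))))

  Σ-bipartitions-assoc : (B : List A) (F : List A → List A → List A → ℤ) →
    Σ₂ (bipartitions B) (λ G H → Σ₂ (bipartitions G) (λ G₁ G₂ → F G₁ G₂ H)) ≡ Σ₃ (tripartitions B) F
  Σ-bipartitions-assoc []       F = ℤP.+-identityʳ _
  Σ-bipartitions-assoc (x ∷ xs) F = begin
      Σ₂ (bipartitions (x ∷ xs)) Φ
    ≡⟨ Σ₂-bipartitions-∷ x xs Φ ⟩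
      Σ₂ (bipartitions xs) (λ G H → Φ (x ∷ G) H) + Σ₂ (bipartitions xs) (λ G H → Φ G (x ∷ H))
    ≡⟨ cong (λ z → z + Σ₂ (bipartitions xs) (λ G H → Φ G (x ∷ H)))
         (trans (Σ-cong (bipartitions xs) (λ p → Σ₂-bipartitions-∷ x (proj₁ p) (λ a b → F a b (proj₂ p))))
                (Σ-+ (bipartitions xs) _ _)) ⟩
      (Σ₂ (bipartitions xs) (λ G H → Σ₂ (bipartitions G) (λ a b → F (x ∷ a) b H))
        + Σ₂ (bipartitions xs) (λ G H → Σ₂ (bipartitions G) (λ a b → F a (x ∷ b) H)))
        + Σ₂ (bipartitions xs) (λ G H → Φ G (x ∷ H))
    ≡⟨ cong₂ _+_ (cong₂ _+_ (Σ-bipartitions-assoc xs (λ a b c → F (x ∷ a) b c))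
                            (Σ-bipartitions-assoc xs (λ a b c → F a (x ∷ b) c)))
                 (Σ-bipartitions-assoc xs (λ a b c → F a b (x ∷ c))) ⟩
      (Σ₃ (tripartitions xs) (λ a b c → F (x ∷ a) b c) + Σ₃ (tripartitions xs) (λ a b c → F a (x ∷ b) c))
        + Σ₃ (tripartitions xs) (λ a b c → F a b (x ∷ c))
    ≡⟨ trans (ℤP.+-assoc (Σ₃ (tripartitions xs) (λ a b c → F (x ∷ a) b c)) _ _) (sym (Σ₃-tripartitions-∷ x xs F)) ⟩
      Σ₃ (tripartitions (x ∷ xs)) F
    ∎
    where
    open ≡-Reasoning
    Φ : List A → List A → ℤ
    Φ G H = Σ₂ (bipartitions G) (λ a b → F a b H)

  Σ-tripartitions-rotate : (B : List A) (F : List A → List A → List A → ℤ) →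
    Σ₃ (tripartitions B) F ≡ Σ₃ (tripartitions B) (λ a b c → F b c a)
  Σ-tripartitions-rotate []       F = refl
  Σ-tripartitions-rotate (x ∷ xs) F = begin
      Σ₃ (tripartitions (x ∷ xs)) F
    ≡⟨ Σ₃-tripartitions-∷ x xs F ⟩
      S₁ + (S₂ + S₃)
    ≡⟨ rotate S₁ S₂ S₃ ⟩
      S₃ + (S₁ + S₂)
    ≡⟨ cong₂ _+_ (Σ-tripartitions-rotate xs (λ a b c → F a b (x ∷ c)))
         (cong₂ _+_ (Σ-tripartitions-rotate xs (λ a b c → F (x ∷ a) b c))
                    (Σ-tripartitions-rotate xs (λ a b c → F a (x ∷ b) c))) ⟩
      Σ₃ (tripartitions xs) (λ a b c → F b c (x ∷ a))
        + (Σ₃ (tripartitions xs) (λ a b c → F (x ∷ b) c a) + Σ₃ (tripartitions xs) (λ a b c → F b (x ∷ c) a))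
    ≡⟨ sym (Σ₃-tripartitions-∷ x xs (λ a b c → F b c a)) ⟩
      Σ₃ (tripartitions (x ∷ xs)) (λ a b c → F b c a)
    ∎
    where
    open ≡-Reasoning
    S₁ = Σ₃ (tripartitions xs) (λ a b c → F (x ∷ a) b c)
    S₂ = Σ₃ (tripartitions xs) (λ a b c → F a (x ∷ b) c)
    S₃ = Σ₃ (tripartitions xs) (λ a b c → F a b (x ∷ c))
    rotate : ∀ a b c → a + (b + c) ≡ c + (a + b)
    rotate = solve-∀

  insertAll-↭ : (x : A) (l : List A) → All (_↭ x ∷ l) (insertAll x l)
  insertAll-↭ x []       = ↭.refl ∷ []
  insertAll-↭ x (y ∷ ys) =
    ↭.refl ∷ AllP.map⁺ (All.map (λ σ↭ → ↭.trans (prep y σ↭) (swap y x ↭.refl)) (insertAll-↭ x ys))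

  perms-↭ : (B : List A) → All (_↭ B) (perms B)
  perms-↭ []       = ↭.refl ∷ []
  perms-↭ (x ∷ xs) = AllP.concat⁺ (AllP.map⁺ (All.map
    (λ {σ} σ↭ → All.map (λ τ↭ → ↭.trans τ↭ (prep x σ↭)) (insertAll-↭ x σ)) (perms-↭ xs)))

  Σ-perms-isNil : (B : List A) → Σ (perms B) isNil ≡ isNil B
  Σ-perms-isNil []       = refl
  Σ-perms-isNil (x ∷ xs) = trans (Σ-concatMap (insertAll x) (perms xs) isNil)
    (trans (Σ-cong (perms xs) insertAll-isNil) (Σ-zero (perms xs)))
    where
    insertAll-isNil : ∀ l → Σ (insertAll x l) isNil ≡ + 0
    insertAll-isNil []       = refl
    insertAll-isNil (y ∷ ys) = trans (ℤP.+-identityˡ _)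
      (trans (Σ-map (y ∷_) (insertAll x ys) isNil) (Σ-zero (insertAll x ys)))

  Σ-partitions-isNil : (B : List A) → Σ (partitions B) isNil ≡ isNil B
  Σ-partitions-isNil []       = refl
  Σ-partitions-isNil (x ∷ xs) = trans (Σ-concatMap _ (partitions xs) isNil)
    (trans (Σ-cong (partitions xs) (λ p → trans (ℤP.+-identityˡ _) (insertEach-isNil p))) (Σ-zero (partitions xs)))
    where
    insertEach-isNil : ∀ p → Σ (insertEach x p) isNil ≡ + 0
    insertEach-isNil []       = refl
    insertEach-isNil (b ∷ bs) = trans (ℤP.+-identityˡ _)
      (trans (Σ-map (b ∷_) (insertEach x bs) isNil) (Σ-zero (insertEach x bs)))

Unique-resp-↭ : {xs ys : List A} → xs ↭ ys → Unique xs → Unique ys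
Unique-resp-↭ xs↭ys = ↭ₛP.Unique-resp-↭ (setoid _) (↭.↭⇒↭ₛ xs↭ys)

-- Terms with G nonempty involve only strictly shorter H, so the recurrence determines its solution.
bipartition-recurrence-unique : (w : List A → ℤ) {X Y : List A → ℤ} →
  (∀ B → X B ≡ isNil B - Σ₂ (bipartitions B) (λ G H → isCons G * (w G * X H))) →
  (∀ B → Y B ≡ isNil B - Σ₂ (bipartitions B) (λ G H → isCons G * (w G * Y H))) →
  ∀ B → X B ≡ Y B
bipartition-recurrence-unique {A} w {X} {Y} X-rec Y-rec B = bounded (length B) B ℕP.≤-refl
  where
  bipartitions-length : (B : List A) →
    All (λ p → length (proj₁ p) ℕ.+ length (proj₂ p) ≡ length B) (bipartitions B)
  bipartitions-length []       = refl ∷ []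
  bipartitions-length (x ∷ xs) = AllP.++⁺
    (AllP.map⁺ (All.map (cong suc) (bipartitions-length xs)))
    (AllP.map⁺ (All.map (λ {p} e → trans (ℕP.+-suc (length (proj₁ p)) (length (proj₂ p))) (cong suc e))
                        (bipartitions-length xs)))
  bounded : ∀ k B → length B ≤ k → X B ≡ Y B
  bounded zero    []  _ = trans (X-rec []) (sym (Y-rec []))
  bounded (suc k) B |B|≤1+k = trans (X-rec B) (trans (cong (_-_ (isNil B))
      (Σ-cong-All (All.map (λ {p} → term (proj₁ p) (proj₂ p)) (bipartitions-length B)))) (sym (Y-rec B)))
    where
    term : ∀ G H → length G ℕ.+ length H ≡ length B → isCons G * (w G * X H) ≡ isCons G * (w G * Y H)
    term []      H _ = refl
    term (g ∷ G) H e = cong (λ z → + 1 * (w (g ∷ G) * z)) (bounded k H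
      (ℕP.≤-pred (ℕP.≤-trans (s≤s (ℕP.m≤n+m (length H) (length G))) (ℕP.≤-trans (ℕP.≤-reflexive e) |B|≤1+k))))

-- A Hamiltonian path makes a vertex set connected

any-∈ : (f : A → Bool) {w : A} {xs : List A} → w ∈ xs → f w ≡ true → any f xs ≡ true
any-∈ f (here refl) fw rewrite fw = refl
any-∈ f {xs = x ∷ xs} (there w∈xs) fw rewrite any-∈ f w∈xs fw = ∨-zeroʳ (f x)

all-∈ : (f : A → Bool) (xs : List A) → (∀ {u} → u ∈ xs → f u ≡ true) → all f xs ≡ true
all-∈ f []       _ = refl
all-∈ f (x ∷ xs) k rewrite k (here refl) = all-∈ f xs (λ u∈xs → k (there u∈xs))

⌊≟⌋-refl : ∀ {n} (v : Fin n) → ⌊ v ≟ v ⌋ ≡ true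
⌊≟⌋-refl v with v ≟ v
... | yes _  = refl
... | no v≢v = ⊥-elim (v≢v refl)

isPath-tail : ∀ {n} (Γ : Graph n) w σ → isPath Γ (w ∷ σ) ≡ true → isPath Γ σ ≡ true
isPath-tail Γ w []      _ = refl
isPath-tail Γ w (v ∷ σ) p with adj Γ w v
... | true = p

isPath-head : ∀ {n} (Γ : Graph n) w v σ → isPath Γ (w ∷ v ∷ σ) ≡ true → adj Γ w v ≡ true
isPath-head Γ w v σ p with adj Γ w v
... | true  = refl
... | false = p

module _ {n : ℕ} (Γ : Graph n) (G : List (Fin n)) where

  -- A record, so that the endpoints can be inferred from a proof.
  record Reach (u : Fin n) (k : ℕ) (v : Fin n) : Set where
    constructor reached
    field reach≡true : reach Γ G u k v ≡ true
  open Reach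

  reach-refl : ∀ u → Reach u 0 u
  reach-refl u = reached (⌊≟⌋-refl u)

  reach-suc : ∀ {u k v} → Reach u k v → Reach u (suc k) v
  reach-suc {u} {k} {v} (reached r) =
    reached (cong (λ b → b ∨ ((v ∈ᵇ G) ∧ any (λ w → reach Γ G u k w ∧ adj Γ w v) G)) r)

  reach-mono : ∀ {u k k′ v} → k ≤ k′ → Reach u k v → Reach u k′ v
  reach-mono {k′ = k′} k≤k′ r with ℕP.m≤n⇒∃[o]m+o≡n k≤k′
  ... | o , refl = go o r
    where
    go : ∀ {u k v} o → Reach u k v → Reach u (k ℕ.+ o) v
    go {k = k} zero    r′ rewrite ℕP.+-identityʳ k = r′
    go {k = k} (suc o) r′ rewrite ℕP.+-suc k o = reach-suc (go o r′)

  reach-step : ∀ {u k w v} → Reach u k w → w ∈ G → adj Γ w v ≡ true → v ∈ G → Reach u (suc k) v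
  reach-step {u} {k} {w} {v} (reached r) w∈G wv v∈G = reached step
    where
    step : reach Γ G u (suc k) v ≡ true
    step rewrite any-∈ (λ u′ → ⌊ u′ ≟ v ⌋) v∈G (⌊≟⌋-refl v)
               | any-∈ (λ w′ → reach Γ G u k w′ ∧ adj Γ w′ v) w∈G (trans (cong (λ b → b ∧ adj Γ w v) r) wv)
               = ∨-zeroʳ _

  reach-forward : ∀ {u k} w σ → isPath Γ (w ∷ σ) ≡ true → All (_∈ G) (w ∷ σ) → Reach u k w →
    All (λ v → Reach u (k ℕ.+ length σ) v) (w ∷ σ)
  reach-forward {u} {k} w []      _ _ r rewrite ℕP.+-identityʳ k = r ∷ []
  reach-forward {u} {k} w (v ∷ σ) p (w∈G ∷ σ∈G) r =
    reach-mono (ℕP.m≤m+n k _) r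
    ∷ subst (λ m → All (λ x → Reach u m x) (v ∷ σ)) (sym (ℕP.+-suc k (length σ)))
        (reach-forward v σ (isPath-tail Γ w (v ∷ σ) p) σ∈G
          (reach-step r w∈G (isPath-head Γ w v σ p) (All.head σ∈G)))

  reach-backward : ∀ w σ → isPath Γ (w ∷ σ) ≡ true → All (_∈ G) (w ∷ σ) →
    All (λ u → Reach u (length σ) w) (w ∷ σ)
  reach-backward w []      _ _ = reach-refl w ∷ []
  reach-backward w (v ∷ σ) p (w∈G ∷ σ∈G) =
    reach-mono z≤n (reach-refl w)
    ∷ All.map (λ r → reach-step r (All.head σ∈G) (trans (adj-sym Γ v w) (isPath-head Γ w v σ p)) w∈G)
              (reach-backward v σ (isPath-tail Γ w (v ∷ σ) p) σ∈G)

  reach-path : ∀ σ → isPath Γ σ ≡ true → All (_∈ G) σ → All (λ u → All (λ v → Reach u (length σ) v) σ) σ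
  reach-path []      _ _ = []
  reach-path (w ∷ σ) p σ∈G =
    All.map (reach-mono (ℕP.n≤1+n _)) (reach-forward {k = 0} w σ p σ∈G (reach-refl w))
    ∷ combine (All.tail (reach-backward w σ p σ∈G)) (reach-path σ (isPath-tail Γ w σ p) (All.tail σ∈G))
    where
    combine : ∀ {us} → All (λ u → Reach u (length σ) w) us → All (λ u → All (λ v → Reach u (length σ) v) σ) us →
      All (λ u → All (λ v → Reach u (suc (length σ)) v) (w ∷ σ)) us
    combine []       []       = []
    combine (r ∷ rs) (q ∷ qs) = (reach-suc r ∷ All.map reach-suc q) ∷ combine rs qs

  hamiltonian⇒connectedᵇ : ∀ σ → σ ↭ G → isPath Γ σ ≡ true → connectedᵇ Γ G ≡ true
  hamiltonian⇒connectedᵇ σ σ↭G p = all-∈ _ G (λ u∈G → all-∈ _ G (λ v∈G →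
    subst (λ m → reach Γ G _ m _ ≡ true) (↭P.↭-length σ↭G)
      (reach≡true (All.lookup (All.lookup reach-σ (in-σ u∈G)) (in-σ v∈G)))))
    where
    reach-σ = reach-path σ p (All.tabulate (↭P.∈-resp-↭ σ↭G))
    in-σ : ∀ {x} → x ∈ G → x ∈ σ
    in-σ = ↭P.∈-resp-↭ (↭-sym σ↭G)

-- Anti-paths, partition sums and cycles

signedFactorial : ℕ → ℤ
signedFactorial k = neg1^ k * + (k !)

cyclicWeight : ℕ → ℤ
cyclicWeight k = neg1^ (k ℕ.∸ 1) * + ((k ℕ.∸ 1) !)

isPath-++-∷ : ∀ {n} (Γ : Graph n) α x β → isPath Γ (α ++ x ∷ β) ≡ isPath Γ (α ++ [ x ]) ∧ isPath Γ (x ∷ β)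
isPath-++-∷ Γ []           x β = refl
isPath-++-∷ Γ (a ∷ [])     x β = cong (_∧ isPath Γ (x ∷ β)) (sym (∧-identityʳ (adj Γ a x)))
isPath-++-∷ Γ (a ∷ a′ ∷ α) x β =
  trans (cong (adj Γ a a′ ∧_) (isPath-++-∷ Γ (a′ ∷ α) x β)) (sym (∧-assoc (adj Γ a a′) _ _))

isClosedPath : ∀ {n} → Graph n → Fin n → List (Fin n) → Bool
isClosedPath Γ x π = isPath Γ (x ∷ π) ∧ lastAdjFirst Γ x π

isPath-∷ʳ : ∀ {n} (Γ : Graph n) y p σ x →
  isPath Γ (y ∷ p ∷ σ ++ [ x ]) ≡ isPath Γ (y ∷ p ∷ σ) ∧ lastAdjFirst Γ x (p ∷ σ)
isPath-∷ʳ Γ y p []      x = trans (cong (adj Γ y p ∧_) (∧-identityʳ (adj Γ p x)))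
                                  (cong (_∧ adj Γ p x) (sym (∧-identityʳ (adj Γ y p))))
isPath-∷ʳ Γ y p (q ∷ σ) x = trans (cong (adj Γ y p ∧_) (isPath-∷ʳ Γ p q σ x)) (sym (∧-assoc (adj Γ y p) _ _))

module _ {n : ℕ} (Γ : Graph n) where

  path : List (Fin n) → ℤ
  path σ = 𝟙 (isPath Γ σ)

  isAntiPath : List (Fin n) → Bool
  isAntiPath []           = true
  isAntiPath (x ∷ [])     = true
  isAntiPath (x ∷ y ∷ zs) = not (adj Γ x y) ∧ isAntiPath (y ∷ zs)

  signedAntiPath : List (Fin n) → ℤ
  signedAntiPath σ = neg1^ (length σ) * 𝟙 (isAntiPath σ)

  antiPathSum : List (Fin n) → ℤ
  antiPathSum B = Σ (perms B) signedAntiPath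

  hp : List (Fin n) → ℤ
  hp G = + HPon Γ G

  hpProduct : List (List (Fin n)) → ℤ
  hpProduct I = + product (map (HPon Γ) I)

  partitionSum : List (Fin n) → ℤ
  partitionSum B = Σ (partitions B) (λ I → signedFactorial (length I) * hpProduct I)

  isAntiPath-Linked : ∀ {σ} → Linked _≢_ σ → isAntiPath σ ≡ isPath (complement Γ) σ
  isAntiPath-Linked []  = refl
  isAntiPath-Linked [-] = refl
  isAntiPath-Linked {x ∷ y ∷ _} (x≢y ∷ linked) with x ≟ y
  ... | yes x≡y = ⊥-elim (x≢y x≡y)
  ... | no _    = cong₂ _∧_ (sym (∧-identityʳ _)) (isAntiPath-Linked linked)

  -- If y is adjacent to its successor z, the terms with s nonempty sum to - signedAntiPath (z ∷ σ) by induction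
  -- and cancel the term s = []; otherwise only the term s = [] survives.
  signedAntiPath-∷ : ∀ y σ → signedAntiPath (y ∷ σ) ≡ - Σ₂ (splits σ) (λ s t → path (y ∷ s) * signedAntiPath t)
  signedAntiPath-∷ y []      = refl
  signedAntiPath-∷ y (z ∷ σ) with adj Γ y z in yz
  ... | true = begin
      neg1^ (suc (suc (length σ))) * + 0
    ≡⟨ ℤP.*-zeroʳ (neg1^ (suc (suc (length σ)))) ⟩
      + 0
    ≡⟨ sym (cong -_ (ℤP.+-inverseʳ (signedAntiPath (z ∷ σ)))) ⟩
      - (signedAntiPath (z ∷ σ) - signedAntiPath (z ∷ σ))
    ≡⟨ cong (λ u → - (u - signedAntiPath (z ∷ σ))) (sym (ℤP.*-identityˡ (signedAntiPath (z ∷ σ)))) ⟩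
      - (+ 1 * signedAntiPath (z ∷ σ) - signedAntiPath (z ∷ σ))
    ≡⟨ cong (λ u → - (+ 1 * signedAntiPath (z ∷ σ) + u))
         (trans (cong -_ (signedAntiPath-∷ z σ)) (ℤP.neg-involutive _)) ⟩
      - (+ 1 * signedAntiPath (z ∷ σ) + Σ₂ (splits σ) (λ s t → path (z ∷ s) * signedAntiPath t))
    ≡⟨ cong (λ u → - (+ 1 * signedAntiPath (z ∷ σ) + u))
         (sym (trans (Σ₂-map-cons₁ z (splits σ) _) (Σ-cong (splits σ) path-yz))) ⟩
      - (+ 1 * signedAntiPath (z ∷ σ) + Σ₂ (map (cons₁ z) (splits σ)) (λ s t → path (y ∷ s) * signedAntiPath t))
    ∎
    where
    open ≡-Reasoning
    path-yz : (p : List (Fin n) × List (Fin n)) →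
      path (y ∷ z ∷ proj₁ p) * signedAntiPath (proj₂ p) ≡ path (z ∷ proj₁ p) * signedAntiPath (proj₂ p)
    path-yz _ rewrite yz = refl
  ... | false = begin
      neg1^ (suc (suc (length σ))) * 𝟙 (isAntiPath (z ∷ σ))
    ≡⟨ sym (ℤP.neg-distribˡ-* (neg1^ (suc (length σ))) (𝟙 (isAntiPath (z ∷ σ)))) ⟩
      - signedAntiPath (z ∷ σ)
    ≡⟨ cong -_ (sym (trans (cong₂ _+_ (ℤP.*-identityˡ (signedAntiPath (z ∷ σ)))
         (trans (Σ₂-map-cons₁ z (splits σ) _) (trans (Σ-cong (splits σ) no-path-yz) (Σ-zero (splits σ)))))
         (ℤP.+-identityʳ _))) ⟩
      - (+ 1 * signedAntiPath (z ∷ σ) + Σ₂ (map (cons₁ z) (splits σ)) (λ s t → path (y ∷ s) * signedAntiPath t))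
    ∎
    where
    open ≡-Reasoning
    no-path-yz : (p : List (Fin n) × List (Fin n)) → path (y ∷ z ∷ proj₁ p) * signedAntiPath (proj₂ p) ≡ + 0
    no-path-yz _ rewrite yz = refl

  signedAntiPath-splits : ∀ σ →
    signedAntiPath σ ≡ isNil σ - Σ₂ (splits σ) (λ s t → isCons s * (path s * signedAntiPath t))
  signedAntiPath-splits []      = refl
  signedAntiPath-splits (y ∷ σ) = begin
      signedAntiPath (y ∷ σ)
    ≡⟨ signedAntiPath-∷ y σ ⟩
      - Σ₂ (splits σ) (λ s t → path (y ∷ s) * signedAntiPath t)
    ≡⟨ cong -_ (Σ-cong (splits σ) (λ _ → sym (ℤP.*-identityˡ _))) ⟩
      - Σ₂ (splits σ) (λ s t → isCons (y ∷ s) * (path (y ∷ s) * signedAntiPath t))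
    ≡⟨ cong -_ (sym (Σ₂-map-cons₁ y (splits σ) _)) ⟩
      - Σ₂ (map (cons₁ y) (splits σ)) (λ s t → isCons s * (path s * signedAntiPath t))
    ≡⟨ trans (cong -_ (sym (ℤP.+-identityˡ _))) (sym (ℤP.+-identityˡ _)) ⟩
      + 0 - (+ 0 + Σ₂ (map (cons₁ y) (splits σ)) (λ s t → isCons s * (path s * signedAntiPath t)))
    ∎
    where open ≡-Reasoning

  hp≡Σ-path : ∀ G → hp G ≡ Σ (perms G) path
  hp≡Σ-path G = countᵇ≡Σ (isPath Γ) (perms G)

  Σ-perms-isCons-path : ∀ G → Σ (perms G) (λ σ → isCons σ * path σ) ≡ isCons G * hp G
  Σ-perms-isCons-path []       = refl
  Σ-perms-isCons-path (x ∷ xs) = begin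
      Σ (concatMap (insertAll x) (perms xs)) (λ σ → isCons σ * path σ)
    ≡⟨ Σ-concatMap (insertAll x) (perms xs) _ ⟩
      Σ (perms xs) (λ ρ → Σ (insertAll x ρ) (λ σ → isCons σ * path σ))
    ≡⟨ Σ-cong (perms xs) (λ ρ → Σ-cong-All (All.map (λ {σ} σ↭ → isCons-↭ σ σ↭) (insertAll-↭ x ρ))) ⟩
      Σ (perms xs) (λ ρ → Σ (insertAll x ρ) path)
    ≡⟨ sym (trans (hp≡Σ-path (x ∷ xs)) (Σ-concatMap (insertAll x) (perms xs) path)) ⟩
      hp (x ∷ xs)
    ≡⟨ sym (ℤP.*-identityˡ _) ⟩
      isCons (x ∷ xs) * hp (x ∷ xs)
    ∎
    where
    open ≡-Reasoning
    isCons-↭ : ∀ σ {ρ} → σ ↭ x ∷ ρ → isCons σ * path σ ≡ path σ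
    isCons-↭ [] σ↭ with () ← ↭P.↭-length σ↭
    isCons-↭ (_ ∷ _) _ = ℤP.*-identityˡ _

  antiPathSum-rec : ∀ B → antiPathSum B ≡ isNil B - Σ₂ (bipartitions B) (λ G H → isCons G * (hp G * antiPathSum H))
  antiPathSum-rec B = begin
      Σ (perms B) signedAntiPath
    ≡⟨ Σ-cong (perms B) signedAntiPath-splits ⟩
      Σ (perms B) (λ σ → isNil σ - Σ₂ (splits σ) g)
    ≡⟨ Σ-minus (perms B) _ _ ⟩
      Σ (perms B) isNil - Σ (perms B) (λ σ → Σ₂ (splits σ) g)
    ≡⟨ cong₂ _-_ (Σ-perms-isNil B)
         (trans (Σ-perms-splits B g) (Σ-cong (bipartitions B) (λ p → factor (proj₁ p) (proj₂ p)))) ⟩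
      isNil B - Σ₂ (bipartitions B) (λ G H → isCons G * (hp G * antiPathSum H))
    ∎
    where
    open ≡-Reasoning
    g : List (Fin n) → List (Fin n) → ℤ
    g s t = isCons s * (path s * signedAntiPath t)
    factor : ∀ G H → Σ (perms G) (λ s → Σ (perms H) (g s)) ≡ isCons G * (hp G * antiPathSum H)
    factor G H = begin
        Σ (perms G) (λ s → Σ (perms H) (g s))
      ≡⟨ Σ-cong (perms G) (λ s → trans (Σ-cong (perms H) (λ t → sym (ℤP.*-assoc (isCons s) (path s) _)))
                                       (Σ-*ˡ (isCons s * path s) (perms H) signedAntiPath)) ⟩
        Σ (perms G) (λ s → (isCons s * path s) * antiPathSum H)
      ≡⟨ Σ-*ʳ (antiPathSum H) (perms G) _ ⟩
        Σ (perms G) (λ s → isCons s * path s) * antiPathSum H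
      ≡⟨ cong (_* antiPathSum H) (Σ-perms-isCons-path G) ⟩
        (isCons G * hp G) * antiPathSum H
      ≡⟨ ℤP.*-assoc (isCons G) (hp G) (antiPathSum H) ⟩
        isCons G * (hp G * antiPathSum H)
      ∎

  hpProduct-∷ : ∀ G I → hpProduct (G ∷ I) ≡ hp G * hpProduct I
  hpProduct-∷ G I = ℤP.pos-* (HPon Γ G) (product (map (HPon Γ) I))

  Σ-selections-hpProduct : (φ : ℕ → ℤ) (G : List (Fin n)) (I : List (List (Fin n))) →
    Σ₂ (selections (G ∷ I)) (λ G′ J → hp G′ * (φ (length J) * hpProduct J))
      ≡ + suc (length I) * (φ (length I) * hpProduct (G ∷ I))
  Σ-selections-hpProduct φ G [] = trans (ℤP.+-identityʳ _)
    (trans (rearrange (hp G) (φ 0) (hpProduct [])) (cong (λ z → + 1 * (φ 0 * z)) (sym (hpProduct-∷ G []))))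
    where
    rearrange : ∀ a f x → a * (f * x) ≡ + 1 * (f * (a * x))
    rearrange = solve-∀
  Σ-selections-hpProduct φ G (G′ ∷ I) = begin
      hp G * (φ k * hpProduct (G′ ∷ I)) + Σ₂ (map (consRest G) (selections (G′ ∷ I))) F
    ≡⟨ cong (_+_ (hp G * (φ k * hpProduct (G′ ∷ I)))) (trans (Σ₂-map-consRest G (selections (G′ ∷ I)) F)
         (trans (Σ-cong (selections (G′ ∷ I)) F-cons) (Σ-*ˡ (hp G) (selections (G′ ∷ I)) _))) ⟩
      hp G * (φ k * hpProduct (G′ ∷ I))
        + hp G * Σ₂ (selections (G′ ∷ I)) (λ H J → hp H * (φ (suc (length J)) * hpProduct J))
    ≡⟨ cong (λ z → hp G * (φ k * hpProduct (G′ ∷ I)) + hp G * z) (Σ-selections-hpProduct (λ m → φ (suc m)) G′ I) ⟩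
      hp G * (φ k * hpProduct (G′ ∷ I)) + hp G * (+ k * (φ k * hpProduct (G′ ∷ I)))
    ≡⟨ rearrange (hp G) (φ k) (hpProduct (G′ ∷ I)) (+ k) ⟩
      (+ 1 + + k) * (φ k * (hp G * hpProduct (G′ ∷ I)))
    ≡⟨ cong₂ (λ u v → u * (φ k * v)) (sym (ℤP.pos-+ 1 k)) (sym (hpProduct-∷ G (G′ ∷ I))) ⟩
      + suc k * (φ k * hpProduct (G ∷ G′ ∷ I))
    ∎
    where
    open ≡-Reasoning
    k = suc (length I)
    F : List (Fin n) → List (List (Fin n)) → ℤ
    F H J = hp H * (φ (length J) * hpProduct J)
    commute : ∀ a g f x → g * (f * (a * x)) ≡ a * (g * (f * x))
    commute = solve-∀
    F-cons : (p : List (Fin n) × List (List (Fin n))) →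
      F (proj₁ p) (G ∷ proj₂ p) ≡ hp G * (hp (proj₁ p) * (φ (suc (length (proj₂ p))) * hpProduct (proj₂ p)))
    F-cons (H , J) = trans (cong (λ z → hp H * (φ (suc (length J)) * z)) (hpProduct-∷ G J))
                           (commute (hp G) (hp H) (φ (suc (length J))) (hpProduct J))
    rearrange : ∀ a f x m → a * (f * x) + a * (m * (f * x)) ≡ (+ 1 + m) * (f * (a * x))
    rearrange = solve-∀

  -- Selecting one of the k+1 blocks turns (k+1)! into k!.
  signedFactorial-selections : ∀ I →
    signedFactorial (length I) * hpProduct I
      ≡ isNil I - Σ₂ (selections I) (λ G J → hp G * (signedFactorial (length J) * hpProduct J))
  signedFactorial-selections []      = refl
  signedFactorial-selections (G ∷ I) = begin
      (neg1^ (suc k) * + (suc k ℕ.* (k !))) * hpProduct (G ∷ I)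
    ≡⟨ cong (λ z → (neg1^ (suc k) * z) * hpProduct (G ∷ I)) (ℤP.pos-* (suc k) (k !)) ⟩
      ((- neg1^ k) * (+ suc k * + (k !))) * hpProduct (G ∷ I)
    ≡⟨ rearrange (neg1^ k) (+ suc k) (+ (k !)) (hpProduct (G ∷ I)) ⟩
      + 0 - + suc k * (signedFactorial k * hpProduct (G ∷ I))
    ≡⟨ cong (_-_ (+ 0)) (sym (Σ-selections-hpProduct signedFactorial G I)) ⟩
      + 0 - Σ₂ (selections (G ∷ I)) (λ G′ J → hp G′ * (signedFactorial (length J) * hpProduct J))
    ∎
    where
    open ≡-Reasoning
    k = length I
    rearrange : ∀ s m f x → ((- s) * (m * f)) * x ≡ + 0 - m * ((s * f) * x)
    rearrange = solve-∀

  partitionSum-rec : ∀ B →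
    partitionSum B ≡ isNil B - Σ₂ (bipartitions B) (λ G H → isCons G * (hp G * partitionSum H))
  partitionSum-rec B = begin
      Σ (partitions B) (λ I → signedFactorial (length I) * hpProduct I)
    ≡⟨ Σ-cong (partitions B) signedFactorial-selections ⟩
      Σ (partitions B) (λ I → isNil I - Σ₂ (selections I) F)
    ≡⟨ Σ-minus (partitions B) _ _ ⟩
      Σ (partitions B) isNil - Σ (partitions B) (λ I → Σ₂ (selections I) F)
    ≡⟨ cong₂ _-_ (Σ-partitions-isNil B) (trans (Σ-partitions-selections B F)
         (Σ-cong (bipartitions B) (λ p → cong (_*_ (isCons (proj₁ p))) (Σ-*ˡ (hp (proj₁ p)) (partitions (proj₂ p)) _)))) ⟩
      isNil B - Σ₂ (bipartitions B) (λ G H → isCons G * (hp G * partitionSum H))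
    ∎
    where
    open ≡-Reasoning
    F : List (Fin n) → List (List (Fin n)) → ℤ
    F G J = hp G * (signedFactorial (length J) * hpProduct J)

  partitionSum≡antiPathSum : ∀ B → partitionSum B ≡ antiPathSum B
  partitionSum≡antiPathSum = bipartition-recurrence-unique hp partitionSum-rec antiPathSum-rec

  HPon-disconnected : ∀ G → connectedᵇ Γ G ≡ false → HPon Γ G ≡ 0
  HPon-disconnected G disc = countᵇ-none (isPath Γ) (All.map not-path (perms-↭ G))
    where
    not-path : ∀ {σ} → σ ↭ G → isPath Γ σ ≡ false
    not-path {σ} σ↭G with isPath Γ σ in p
    ... | false = refl
    ... | true with () ← trans (sym (hamiltonian⇒connectedᵇ Γ G σ σ↭G p)) disc

  product-HPon-disconnected : ∀ I → all (connectedᵇ Γ) I ≡ false → product (map (HPon Γ) I) ≡ 0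
  product-HPon-disconnected []      ()
  product-HPon-disconnected (G ∷ I) disc with connectedᵇ Γ G in conn
  ... | false rewrite HPon-disconnected G conn = refl
  ... | true  rewrite product-HPon-disconnected I disc = ℕP.*-zeroʳ (HPon Γ G)

  cyclicPartitionSum : List (Fin n) → ℤ
  cyclicPartitionSum B = Σ (partitions B) (λ I → cyclicWeight (length I) * hpProduct I)

  Σ-insertEach-hpProduct : (x : Fin n) (φ : ℕ → ℤ) (I : List (List (Fin n))) →
    Σ (insertEach x I) (λ J → φ (length J) * hpProduct J)
      ≡ Σ₂ (selections I) (λ G J → hp (x ∷ G) * (φ (suc (length J)) * hpProduct J))
  Σ-insertEach-hpProduct x φ []      = refl
  Σ-insertEach-hpProduct x φ (G ∷ I) = cong₂ _+_ head-term tail-terms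
    where
    open ≡-Reasoning
    commute : ∀ f a X → f * (a * X) ≡ a * (f * X)
    commute = solve-∀
    commute₃ : ∀ a c f X → a * (c * (f * X)) ≡ c * (f * (a * X))
    commute₃ = solve-∀
    head-term : φ (suc (length I)) * hpProduct ((x ∷ G) ∷ I) ≡ hp (x ∷ G) * (φ (suc (length I)) * hpProduct I)
    head-term = trans (cong (φ (suc (length I)) *_) (hpProduct-∷ (x ∷ G) I))
                      (commute (φ (suc (length I))) (hp (x ∷ G)) (hpProduct I))
    tail-terms : Σ (map (G ∷_) (insertEach x I)) (λ J → φ (length J) * hpProduct J)
      ≡ Σ₂ (map (consRest G) (selections I)) (λ H J → hp (x ∷ H) * (φ (suc (length J)) * hpProduct J))
    tail-terms = begin
        Σ (map (G ∷_) (insertEach x I)) (λ J → φ (length J) * hpProduct J)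
      ≡⟨ Σ-map (G ∷_) (insertEach x I) _ ⟩
        Σ (insertEach x I) (λ J → φ (suc (length J)) * hpProduct (G ∷ J))
      ≡⟨ Σ-cong (insertEach x I) (λ J → trans (cong (φ (suc (length J)) *_) (hpProduct-∷ G J))
                                             (commute (φ (suc (length J))) (hp G) (hpProduct J))) ⟩
        Σ (insertEach x I) (λ J → hp G * (φ (suc (length J)) * hpProduct J))
      ≡⟨ Σ-*ˡ (hp G) (insertEach x I) _ ⟩
        hp G * Σ (insertEach x I) (λ J → φ (suc (length J)) * hpProduct J)
      ≡⟨ cong (hp G *_) (Σ-insertEach-hpProduct x (λ k → φ (suc k)) I) ⟩
        hp G * Σ₂ (selections I) (λ H J → hp (x ∷ H) * (φ (suc (suc (length J))) * hpProduct J))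
      ≡⟨ sym (Σ-*ˡ (hp G) (selections I) _) ⟩
        Σ₂ (selections I) (λ H J → hp G * (hp (x ∷ H) * (φ (suc (suc (length J))) * hpProduct J)))
      ≡⟨ Σ-cong (selections I) (λ p → trans (commute₃ (hp G) (hp (x ∷ proj₁ p)) (φ (suc (suc (length (proj₂ p))))) (hpProduct (proj₂ p)))
           (cong (λ z → hp (x ∷ proj₁ p) * (φ (suc (suc (length (proj₂ p)))) * z)) (sym (hpProduct-∷ G (proj₂ p))))) ⟩
        Σ₂ (selections I) (λ H J → hp (x ∷ H) * (φ (suc (suc (length J))) * hpProduct (G ∷ J)))
      ≡⟨ sym (Σ₂-map-consRest G (selections I) _) ⟩
        Σ₂ (map (consRest G) (selections I)) (λ H J → hp (x ∷ H) * (φ (suc (length J)) * hpProduct J))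
      ∎

  -- Split off the block x ∷ G containing x; the weight (k-1)! of the k blocks becomes the weight k! of the remaining ones.
  cyclicPartitionSum-∷ : ∀ x xs →
    cyclicPartitionSum (x ∷ xs) ≡ Σ₂ (bipartitions xs) (λ G H → hp (x ∷ G) * partitionSum H)
  cyclicPartitionSum-∷ x xs = begin
      Σ (concatMap (λ I → ([ x ] ∷ I) ∷ insertEach x I) (partitions xs)) weight
    ≡⟨ Σ-concatMap _ (partitions xs) weight ⟩
      Σ (partitions xs) (λ I → weight ([ x ] ∷ I) + Σ (insertEach x I) weight)
    ≡⟨ Σ-cong (partitions xs) (λ I → cong₂ _+_
         (cong (signedFactorial (length I) *_) (trans (hpProduct-∷ [ x ] I) (ℤP.*-identityˡ (hpProduct I))))
         (Σ-insertEach-hpProduct x cyclicWeight I)) ⟩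
      Σ (partitions xs) (λ I → signedFactorial (length I) * hpProduct I + Σ₂ (selections I) F)
    ≡⟨ Σ-+ (partitions xs) _ _ ⟩
      partitionSum xs + Σ (partitions xs) (λ I → Σ₂ (selections I) F)
    ≡⟨ cong₂ _+_ (sym (ℤP.*-identityˡ (partitionSum xs)))
         (trans (Σ-partitions-selections xs F) (Σ-cong (bipartitions xs)
           (λ p → cong (isCons (proj₁ p) *_) (Σ-*ˡ (hp (x ∷ proj₁ p)) (partitions (proj₂ p)) _)))) ⟩
      hp [ x ] * partitionSum xs + Σ₂ (bipartitions xs) (λ G H → isCons G * (hp (x ∷ G) * partitionSum H))
    ≡⟨ sym (Σ-bipartitions-emptyˡ xs (λ G H → hp (x ∷ G) * partitionSum H)) ⟩
      Σ₂ (bipartitions xs) (λ G H → hp (x ∷ G) * partitionSum H)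
    ∎
    where
    open ≡-Reasoning
    weight : List (List (Fin n)) → ℤ
    weight I = cyclicWeight (length I) * hpProduct I
    F : List (Fin n) → List (List (Fin n)) → ℤ
    F G J = hp (x ∷ G) * (signedFactorial (length J) * hpProduct J)

  hp-∷ : ∀ x G → hp (x ∷ G) ≡ Σ (perms G) (λ ρ → Σ₂ (splits ρ) (λ α β → path (α ++ [ x ]) * path (x ∷ β)))
  hp-∷ x G = trans (hp≡Σ-path (x ∷ G)) (trans (Σ-concatMap (insertAll x) (perms G) path)
    (Σ-cong (perms G) (λ ρ → trans (Σ-insertAll x ρ path) (Σ-cong (splits ρ) (λ p →
      trans (cong 𝟙 (isPath-++-∷ Γ (proj₁ p) x (proj₂ p))) (𝟙-∧ (isPath Γ (proj₁ p ++ [ x ])) (isPath Γ (x ∷ proj₂ p))))))))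

  throughSum : Fin n → List (Fin n) → List (Fin n) → List (Fin n) → ℤ
  throughSum x A B C =
    Σ (perms A) (λ α → Σ (perms B) (λ β → Σ (perms C) (λ τ → path (α ++ [ x ]) * (path (x ∷ β) * signedAntiPath τ))))

  Σ-hp-∷-antiPathSum : ∀ x xs →
    Σ₂ (bipartitions xs) (λ G H → hp (x ∷ G) * antiPathSum H) ≡ Σ₃ (tripartitions xs) (throughSum x)
  Σ-hp-∷-antiPathSum x xs =
    trans (Σ-cong (bipartitions xs) (λ p → expand (proj₁ p) (proj₂ p))) (Σ-bipartitions-assoc xs (throughSum x))
    where
    open ≡-Reasoning
    term : List (Fin n) → List (Fin n) → List (Fin n) → ℤ
    term α β τ = path (α ++ [ x ]) * (path (x ∷ β) * signedAntiPath τ)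
    expand : ∀ G H → hp (x ∷ G) * antiPathSum H ≡ Σ₂ (bipartitions G) (λ G₁ G₂ → throughSum x G₁ G₂ H)
    expand G H = begin
        hp (x ∷ G) * antiPathSum H
      ≡⟨ cong (_* antiPathSum H) (hp-∷ x G) ⟩
        Σ (perms G) (λ ρ → Σ₂ (splits ρ) (λ α β → path (α ++ [ x ]) * path (x ∷ β))) * antiPathSum H
      ≡⟨ sym (Σ-*ʳ (antiPathSum H) (perms G) _) ⟩
        Σ (perms G) (λ ρ → Σ₂ (splits ρ) (λ α β → path (α ++ [ x ]) * path (x ∷ β)) * antiPathSum H)
      ≡⟨ Σ-cong (perms G) (λ ρ → trans (sym (Σ-*ʳ (antiPathSum H) (splits ρ) _)) (Σ-cong (splits ρ) (λ q →
           trans (sym (Σ-*ˡ (path (proj₁ q ++ [ x ]) * path (x ∷ proj₂ q)) (perms H) signedAntiPath))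
                 (Σ-cong (perms H) (λ τ → ℤP.*-assoc (path (proj₁ q ++ [ x ])) (path (x ∷ proj₂ q)) (signedAntiPath τ)))))) ⟩
        Σ (perms G) (λ ρ → Σ₂ (splits ρ) (λ α β → Σ (perms H) (term α β)))
      ≡⟨ Σ-perms-splits G (λ α β → Σ (perms H) (term α β)) ⟩
        Σ₂ (bipartitions G) (λ G₁ G₂ → throughSum x G₁ G₂ H)
      ∎

  -- A sum over the decompositions π = β ++ τ ++ α.
  bridgeSum : Fin n → Fin n → List (Fin n) → ℤ
  bridgeSum a z π =
    Σ₂ (splits π) (λ v α → Σ₂ (splits v) (λ β τ → path (α ++ [ z ]) * (path (a ∷ β) * signedAntiPath τ)))

  -- Both sides sum over three disjoint permuted parts, in rotated roles.
  Σ-perms-bridgeSum : ∀ x xs → Σ (perms xs) (bridgeSum x x) ≡ Σ₃ (tripartitions xs) (throughSum x)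
  Σ-perms-bridgeSum x xs = begin
      Σ (perms xs) (λ π → Σ₂ (splits π) K)
    ≡⟨ Σ-perms-splits xs K ⟩
      Σ₂ (bipartitions xs) (λ V A → Σ (perms V) (λ v → Σ (perms A) (K v)))
    ≡⟨ Σ-cong (bipartitions xs) (λ p → expand (proj₁ p) (proj₂ p)) ⟩
      Σ₂ (bipartitions xs) (λ V A → Σ₂ (bipartitions V) (λ V₁ V₂ → throughSum x A V₁ V₂))
    ≡⟨ Σ-bipartitions-assoc xs (λ a b c → throughSum x c a b) ⟩
      Σ₃ (tripartitions xs) (λ a b c → throughSum x c a b)
    ≡⟨ Σ-tripartitions-rotate xs (λ a b c → throughSum x c a b) ⟩
      Σ₃ (tripartitions xs) (throughSum x)
    ∎
    where
    open ≡-Reasoning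
    term : List (Fin n) → List (Fin n) → List (Fin n) → ℤ
    term α β τ = path (α ++ [ x ]) * (path (x ∷ β) * signedAntiPath τ)
    K : List (Fin n) → List (Fin n) → ℤ
    K v α = Σ₂ (splits v) (term α)
    expand : ∀ V A → Σ (perms V) (λ v → Σ (perms A) (K v)) ≡ Σ₂ (bipartitions V) (λ V₁ V₂ → throughSum x A V₁ V₂)
    expand V A = begin
        Σ (perms V) (λ v → Σ (perms A) (K v))
      ≡⟨ Σ-swap (perms V) (perms A) K ⟩
        Σ (perms A) (λ α → Σ (perms V) (λ v → K v α))
      ≡⟨ Σ-cong (perms A) (λ α → Σ-perms-splits V (term α)) ⟩
        Σ (perms A) (λ α → Σ₂ (bipartitions V) (λ V₁ V₂ → Σ (perms V₁) (λ β → Σ (perms V₂) (term α β))))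
      ≡⟨ Σ-swap (perms A) (bipartitions V) _ ⟩
        Σ₂ (bipartitions V) (λ V₁ V₂ → throughSum x A V₁ V₂)
      ∎

  -- The three terms: y starts α (so β = τ = []), y starts τ, y starts β.
  bridgeSum-∷ : ∀ a z y π →
    bridgeSum a z (y ∷ π) ≡ path (y ∷ π ++ [ z ]) - bridgeSum y z π + 𝟙 (adj Γ a y) * bridgeSum y z π
  bridgeSum-∷ a z y π = begin
      K a [] (y ∷ π) + Σ₂ (map (cons₁ y) (splits π)) (K a)
    ≡⟨ cong₂ _+_ (unit (path (y ∷ π ++ [ z ])))
         (trans (Σ₂-map-cons₁ y (splits π) (K a)) (Σ-cong (splits π) (λ p → K-∷ (proj₁ p) (proj₂ p)))) ⟩
      path (y ∷ π ++ [ z ]) + Σ₂ (splits π) (λ v α → - K y v α + 𝟙 (adj Γ a y) * K y v α)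
    ≡⟨ cong (_+_ (path (y ∷ π ++ [ z ]))) (trans (Σ-+ (splits π) _ _)
         (cong₂ _+_ (Σ-neg (splits π) _) (Σ-*ˡ (𝟙 (adj Γ a y)) (splits π) _))) ⟩
      path (y ∷ π ++ [ z ]) + (- bridgeSum y z π + 𝟙 (adj Γ a y) * bridgeSum y z π)
    ≡⟨ sym (ℤP.+-assoc (path (y ∷ π ++ [ z ])) _ _) ⟩
      path (y ∷ π ++ [ z ]) - bridgeSum y z π + 𝟙 (adj Γ a y) * bridgeSum y z π
    ∎
    where
    open ≡-Reasoning
    K : Fin n → List (Fin n) → List (Fin n) → ℤ
    K b v α = Σ₂ (splits v) (λ β τ → path (α ++ [ z ]) * (path (b ∷ β) * signedAntiPath τ))
    unit : ∀ q → q * (+ 1 * + 1) + + 0 ≡ q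
    unit = solve-∀
    neg-inner : ∀ q x → q * (+ 1 * - x) ≡ - (q * x)
    neg-inner = solve-∀
    commute : ∀ q b c d → q * ((b * c) * d) ≡ b * (q * (c * d))
    commute = solve-∀
    K-∷ : ∀ v α → K a (y ∷ v) α ≡ - K y v α + 𝟙 (adj Γ a y) * K y v α
    K-∷ v α = cong₂ _+_
      (trans (cong (λ u → path (α ++ [ z ]) * (+ 1 * u)) (signedAntiPath-∷ y v))
        (trans (neg-inner (path (α ++ [ z ])) _) (cong -_ (sym (Σ-*ˡ (path (α ++ [ z ])) (splits v) _)))))
      (trans (Σ₂-map-cons₁ y (splits v) _) (trans (Σ-cong (splits v) (λ q →
          trans (cong (λ u → path (α ++ [ z ]) * (u * signedAntiPath (proj₂ q))) (𝟙-∧ (adj Γ a y) (isPath Γ (y ∷ proj₁ q))))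
                (commute (path (α ++ [ z ])) (𝟙 (adj Γ a y)) (path (y ∷ proj₁ q)) (signedAntiPath (proj₂ q)))))
        (Σ-*ˡ (𝟙 (adj Γ a y)) (splits v) _)))

  bridgeSum-closed : ∀ a z π →
    bridgeSum a z π ≡ path (a ∷ π ++ [ z ]) + neg1^ (length π) * 𝟙 (isAntiPath (a ∷ π ++ [ z ]))
  bridgeSum-closed a z []      = base (adj Γ a z)
    where
    base : ∀ b → + 1 ≡ 𝟙 (b ∧ true) + + 1 * 𝟙 (not b ∧ true)
    base true  = refl
    base false = refl
  bridgeSum-closed a z (y ∷ π) = begin
      bridgeSum a z (y ∷ π)
    ≡⟨ bridgeSum-∷ a z y π ⟩
      path (y ∷ π ++ [ z ]) - bridgeSum y z π + 𝟙 (adj Γ a y) * bridgeSum y z π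
    ≡⟨ cong (λ D → path (y ∷ π ++ [ z ]) - D + 𝟙 (adj Γ a y) * D) (bridgeSum-closed y z π) ⟩
      path (y ∷ π ++ [ z ]) - (path (y ∷ π ++ [ z ]) + s * anti) + 𝟙 (adj Γ a y) * (path (y ∷ π ++ [ z ]) + s * anti)
    ≡⟨ step (adj Γ a y) (isPath Γ (y ∷ π ++ [ z ])) (isAntiPath (y ∷ π ++ [ z ])) s ⟩
      path (a ∷ y ∷ π ++ [ z ]) + neg1^ (length (y ∷ π)) * 𝟙 (isAntiPath (a ∷ y ∷ π ++ [ z ]))
    ∎
    where
    open ≡-Reasoning
    s = neg1^ (length π)
    anti = 𝟙 (isAntiPath (y ∷ π ++ [ z ]))
    step : ∀ b c d s → 𝟙 c - (𝟙 c + s * 𝟙 d) + 𝟙 b * (𝟙 c + s * 𝟙 d) ≡ 𝟙 (b ∧ c) + (- s) * 𝟙 (not b ∧ d)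
    step true  c d s = identity (𝟙 c) (𝟙 d) s
      where
      identity : ∀ C D s → C - (C + s * D) + + 1 * (C + s * D) ≡ C + (- s) * + 0
      identity = solve-∀
    step false c d s = identity (𝟙 c) (𝟙 d) s
      where
      identity : ∀ C D s → C - (C + s * D) + + 0 * (C + s * D) ≡ + 0 + (- s) * D
      identity = solve-∀

  cyclicPartitionSum≡Σ-bridgeSum : ∀ x xs → cyclicPartitionSum (x ∷ xs) ≡ Σ (perms xs) (bridgeSum x x)
  cyclicPartitionSum≡Σ-bridgeSum x xs = begin
      cyclicPartitionSum (x ∷ xs)
    ≡⟨ cyclicPartitionSum-∷ x xs ⟩
      Σ₂ (bipartitions xs) (λ G H → hp (x ∷ G) * partitionSum H)
    ≡⟨ Σ-cong (bipartitions xs) (λ p → cong (hp (x ∷ proj₁ p) *_) (partitionSum≡antiPathSum (proj₂ p))) ⟩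
      Σ₂ (bipartitions xs) (λ G H → hp (x ∷ G) * antiPathSum H)
    ≡⟨ Σ-hp-∷-antiPathSum x xs ⟩
      Σ₃ (tripartitions xs) (throughSum x)
    ≡⟨ sym (Σ-perms-bridgeSum x xs) ⟩
      Σ (perms xs) (bridgeSum x x)
    ∎
    where open ≡-Reasoning

  bridgeSum-cycle : ∀ x p π → Unique (x ∷ p ∷ π) →
    bridgeSum x x (p ∷ π)
      ≡ 𝟙 (isClosedPath Γ x (p ∷ π)) + neg1^ (length (p ∷ π)) * 𝟙 (isClosedPath (complement Γ) x (p ∷ π))
  bridgeSum-cycle x p π unique@((x≢p ∷ _) ∷ _) = trans (bridgeSum-closed x x (p ∷ π)) (cong₂ _+_
    (cong 𝟙 (isPath-∷ʳ Γ x p π x))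
    (cong (λ b → neg1^ (length (p ∷ π)) * 𝟙 b)
      (trans (isAntiPath-Linked (x≢p ∷ AllPairs⇒Linked (Unique-resp-↭ (↭P.∷↭∷ʳ x (p ∷ π)) unique)))
             (isPath-∷ʳ (complement Γ) x p π x))))

length-allFin : ∀ m → length (allFin m) ≡ m
length-allFin m = ListP.length-tabulate {n = m} (λ i → i)

allFin-↭-length : ∀ {m} {σ : List (Fin m)} → σ ↭ allFin m → length σ ≡ m
allFin-↭-length {m} σ↭ = trans (↭P.↭-length σ↭) (length-allFin m)

allFin-↭-Unique : ∀ {m} {σ : List (Fin m)} → σ ↭ allFin m → Unique σ
allFin-↭-Unique {m} σ↭ = Unique-resp-↭ (↭-sym σ↭) (UniqueP.allFin⁺ m)

antiPathSum-allFin : ∀ {m} (Γ : Graph m) → antiPathSum Γ (allFin m) ≡ neg1^ m * + HP (complement Γ)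
antiPathSum-allFin {m} Γ = begin
    Σ (perms (allFin m)) (signedAntiPath Γ)
  ≡⟨ Σ-cong-All (All.map complement-path (perms-↭ (allFin m))) ⟩
    Σ (perms (allFin m)) (λ σ → neg1^ m * 𝟙 (isPath (complement Γ) σ))
  ≡⟨ Σ-*ˡ (neg1^ m) (perms (allFin m)) _ ⟩
    neg1^ m * Σ (perms (allFin m)) (λ σ → 𝟙 (isPath (complement Γ) σ))
  ≡⟨ cong (_*_ (neg1^ m)) (sym (countᵇ≡Σ (isPath (complement Γ)) (perms (allFin m)))) ⟩
    neg1^ m * + HP (complement Γ)
  ∎
  where
  open ≡-Reasoning
  complement-path : ∀ {σ} → σ ↭ allFin m → signedAntiPath Γ σ ≡ neg1^ m * 𝟙 (isPath (complement Γ) σ)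
  complement-path σ↭ = cong₂ (λ k b → neg1^ k * 𝟙 b) (allFin-↭-length σ↭)
    (isAntiPath-Linked Γ (AllPairs⇒Linked (allFin-↭-Unique σ↭)))

-- The truncated subtraction |I| ∸ 1 makes the empty partition contribute +1 rather than -1.
lhs₁-weight : ∀ {n} (Γ : Graph n) I →
  neg1^ (length I ℕ.∸ 1) * + (length I !) * hpProduct Γ I
    ≡ - (signedFactorial (length I) * hpProduct Γ I) + + 2 * isNil I
lhs₁-weight Γ []      = refl
lhs₁-weight Γ (G ∷ I) = rearrange (neg1^ (length I)) (+ (suc (length I) !)) (hpProduct Γ (G ∷ I))
  where
  rearrange : ∀ s f x → s * f * x ≡ - (((- s) * f) * x) + + 2 * + 0
  rearrange = solve-∀

LHS₁≡neg-partitionSum : ∀ {n} (Γ : Graph n) → LHS₁ Γ ≡ - partitionSum Γ (allFin n) + + 2 * isNil (allFin n)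
LHS₁≡neg-partitionSum {n} Γ = begin
    LHS₁ Γ
  ≡⟨ Σ-filterᵇ (all (connectedᵇ Γ)) (partitions V) weight
       (λ I disc → trans (cong (λ z → neg1^ (length I ℕ.∸ 1) * + (length I !) * + z) (product-HPon-disconnected Γ I disc))
                         (ℤP.*-zeroʳ (neg1^ (length I ℕ.∸ 1) * + (length I !)))) ⟩
    Σ (partitions V) weight
  ≡⟨ Σ-cong (partitions V) (lhs₁-weight Γ) ⟩
    Σ (partitions V) (λ I → - (signedFactorial (length I) * hpProduct Γ I) + + 2 * isNil I)
  ≡⟨ trans (Σ-+ (partitions V) _ _) (cong₂ _+_ (Σ-neg (partitions V) _)
       (trans (Σ-*ˡ (+ 2) (partitions V) isNil) (cong (_*_ (+ 2)) (Σ-partitions-isNil V)))) ⟩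
    - partitionSum Γ V + + 2 * isNil V
  ∎
  where
  open ≡-Reasoning
  V = allFin n
  weight : List (List (Fin n)) → ℤ
  weight I = neg1^ (length I ℕ.∸ 1) * + (length I !) * hpProduct Γ I

LHS₁≡HP-complement : (n : ℕ) (Γ : Graph (suc n)) → LHS₁ Γ ≡ neg1^ n * + HP (complement Γ)
LHS₁≡HP-complement n Γ = begin
    LHS₁ Γ
  ≡⟨ LHS₁≡neg-partitionSum Γ ⟩
    - partitionSum Γ (allFin (suc n)) + + 2 * + 0
  ≡⟨ cong (λ z → - z + + 2 * + 0) (trans (partitionSum≡antiPathSum Γ (allFin (suc n))) (antiPathSum-allFin Γ)) ⟩
    - (neg1^ (suc n) * + HP (complement Γ)) + + 2 * + 0
  ≡⟨ rearrange (neg1^ n) (+ HP (complement Γ)) ⟩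
    neg1^ n * + HP (complement Γ)
  ∎
  where
  open ≡-Reasoning
  rearrange : ∀ s x → - ((- s) * x) + + 2 * + 0 ≡ s * x
  rearrange = solve-∀

LHS₂≡cyclicPartitionSum : ∀ {n} (Γ : Graph n) → LHS₂ Γ ≡ cyclicPartitionSum Γ (allFin n)
LHS₂≡cyclicPartitionSum {n} Γ = Σ-filterᵇ (all (connectedᵇ Γ)) (partitions (allFin n)) _
  (λ I disc → trans (cong (λ z → cyclicWeight (length I) * + z) (product-HPon-disconnected Γ I disc))
                    (ℤP.*-zeroʳ (cyclicWeight (length I))))

allFin-suc : ∀ m → allFin (suc m) ≡ zero ∷ map suc (allFin m)
allFin-suc m = cong (zero ∷_) (sym (ListP.map-tabulate (λ i → i) suc))

-- The edge only excludes the one-vertex graph, where LHS₂ is 1 but both cycle counts are 0.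
LHS₂≡HC : (n : ℕ) (Γ : Graph (suc n)) → HasEdge Γ → LHS₂ Γ ≡ + HC Γ + neg1^ n * + HC (complement Γ)
LHS₂≡HC zero    Γ (zero , zero , loop) with () ← trans (sym loop) (adj-irrefl Γ zero)
LHS₂≡HC (suc m) Γ _ = begin
    LHS₂ Γ
  ≡⟨ trans (LHS₂≡cyclicPartitionSum Γ) (cong (cyclicPartitionSum Γ) (allFin-suc (suc m))) ⟩
    cyclicPartitionSum Γ (zero ∷ rest)
  ≡⟨ cyclicPartitionSum≡Σ-bridgeSum Γ zero rest ⟩
    Σ (perms rest) (bridgeSum Γ zero zero)
  ≡⟨ Σ-cong-All (All.map cycle-term (perms-↭ rest)) ⟩
    Σ (perms rest) (λ π → 𝟙 (isClosedPath Γ zero π) + neg1^ (suc m) * 𝟙 (isClosedPath (complement Γ) zero π))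
  ≡⟨ trans (Σ-+ (perms rest) _ _)
       (cong (_+_ (Σ (perms rest) (λ π → 𝟙 (isClosedPath Γ zero π)))) (Σ-*ˡ (neg1^ (suc m)) (perms rest) _)) ⟩
    Σ (perms rest) (λ π → 𝟙 (isClosedPath Γ zero π))
      + neg1^ (suc m) * Σ (perms rest) (λ π → 𝟙 (isClosedPath (complement Γ) zero π))
  ≡⟨ sym (cong₂ (λ u v → u + neg1^ (suc m) * v) (countᵇ≡Σ _ (perms rest)) (countᵇ≡Σ _ (perms rest))) ⟩
    + HC Γ + neg1^ (suc m) * + HC (complement Γ)
  ∎
  where
  open ≡-Reasoning
  rest = map suc (allFin (suc m))
  cycle-term : ∀ {π} → π ↭ rest →
    bridgeSum Γ zero zero π ≡ 𝟙 (isClosedPath Γ zero π) + neg1^ (suc m) * 𝟙 (isClosedPath (complement Γ) zero π)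
  cycle-term {[]} π↭ with () ← ↭P.↭-length π↭
  cycle-term {p ∷ π} π↭ = trans
    (bridgeSum-cycle Γ zero p π (Unique-resp-↭ (↭-sym (prep zero π↭)) (subst Unique (allFin-suc (suc m)) (UniqueP.allFin⁺ _))))
    (cong (λ k → 𝟙 (isClosedPath Γ zero (p ∷ π)) + neg1^ k * 𝟙 (isClosedPath (complement Γ) zero (p ∷ π)))
          (trans (↭P.↭-length π↭) (trans (ListP.length-map suc (allFin (suc m))) (length-allFin (suc m)))))

theorem5p1p2 : (n : ℕ) (Γ : Graph (suc n)) → Connected Γ →
    (LHS₁ Γ ≡ neg1^ n * + HP (complement Γ))
    × (HasEdge Γ → LHS₂ Γ ≡ + HC Γ + neg1^ n * + HC (complement Γ))
theorem5p1p2 n Γ _ = LHS₁≡HP-complement n Γ , LHS₂≡HC n Γ
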